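{- Let $n\ge 2$ and $\delta\in\{\mathrm I,\mathrm D\}^n$ with $\delta_1=\delta_n=\mathrm I$. The set of integer $\mathbf d$-flows of the $\delta$-bicho graph $\mathrm{Bic}_\delta$, where $\mathbf d=(0,1,\dots,1,-(n-1))$ on the vertices $(v_0,v_1,\dots,v_{n-1},v_n)$, is in bijection with the set of $\delta$-permutrees on $n$ nodes.
   Context: Decorations $\mathrm I$ (one parent, one child) and $\mathrm D$ (one parent, two children), and also $\mathrm U$ (two parents, one child), $\mathrm X$ (two parents, two children). A $\delta$-permutree is a directed tree on nodes $v_1,\dots,v_n$ (dangling leaf/root edges allowed, so a slot may be empty) where $v_i$ has two parent slots if $\delta_i\in\{\mathrm U,\mathrm X\}$ (one otherwise) and two child slots if $\delta_i\in\{\mathrm D,\mathrm X\}$ (one otherwise); removing $v_i$, each slot gives a (possibly empty) subtree, and with two children (resp. parents) the left descendant (resp. ancestor) subtree has labels $<i$ and the right one labels $>i$. The oruga graph $\mathcal O_n$ has vertices $v_0,\dots,v_n$ and, for each $i\in[n]$, two parallel edges from $v_{n-i}$ to $v_{n+1-i}$: the bump $e^i_0$ and the dip $e^i_1$. An M-move on an edge $(v_a,v_{a+1})$ removes it and adds the edges $(v_0,v_{a+1})$ and $(v_a,v_n)$. For $\delta\in\{\mathrm I,\mathrm D,\mathrm U,\mathrm X\}^n$ with $\delta_1=\delta_n=\mathrm I$, $\mathrm{Bic}_\delta$ is obtained from $\mathcal O_n$ by performing the M-move on $e^i_0$ for each $i$ with $\delta_i\in\{\mathrm U,\mathrm X\}$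 and on $e^i_1$ for each $i$ with $\delta_i\in\{\mathrm D,\mathrm X\}$. An integer $\mathbf d$-flow is $f:E\to\mathbb Z_{\ge0}$ with (outflow) $-$ (inflow) $=\mathbf d_v$ at every vertex $v$. -}

module Defs where

open import Data.Nat using (ℕ; zero; suc; _∸_; _≟_)
open import Data.Integer using (ℤ; +_; -_; _-_; 0ℤ; 1ℤ)
open import Data.Fin using (Fin; toℕ; _<_)
open import Data.Vec using (Vec; lookup)
open import Data.List using (List; []; _∷_; _++_; concatMap; allFin; length; map)
open import Data.Nat.ListAction using (sum)
import Data.List as L
open import Data.Maybe using (Maybe; just; nothing)
open import Data.Product using (Σ; ∃; _×_; _,_; proj₁; proj₂)
open import Data.Unit using (⊤; tt)
open import Data.Empty using (⊥)
open import Data.Bool using (Bool; true; false; if_then_else_)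
open import Relation.Nullary using (¬_)
open import Relation.Nullary.Decidable using (⌊_⌋)
open import Relation.Binary.PropositionalEquality using (_≡_; refl; sym; trans)
open import Relation.Binary.Bundles using (Setoid)

data Deco : Set where
  I D U X : Deco

data DecoID : Set where
  I D : DecoID

toDeco : DecoID → Deco
toDeco I = I
toDeco D = D

-- Every node has exactly one parent slot; a node decorated I has one
-- child slot, a node decorated D has two (left / right) child slots.
-- Nodes v_1..v_n are represented by Fin n (v_{k+1} ↔ k).
-- A permutree is encoded by its parent map: each node either has an empty
-- (dangling) parent slot, or sits in a given child slot of a given node.

data Side : Set where
  left right : Side

ChildSlot : DecoID → Set
ChildSlot I = ⊤
ChildSlot D = Side

IsLeft : (d : DecoID) → ChildSlot d → Set
IsLeft I _ = ⊥
IsLeft D left = ⊤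
IsLeft D right = ⊥

IsRight : (d : DecoID) → ChildSlot d → Set
IsRight I _ = ⊥
IsRight D left = ⊥
IsRight D right = ⊤

module _ {n : ℕ} (δ : Vec DecoID n) where

  ParentPos : Set
  ParentPos = Σ (Fin n) (λ j → ChildSlot (lookup δ j))

  ParentMap : Set
  ParentMap = Fin n → Maybe ParentPos

  data InSubtree (p : ParentMap) (j : Fin n) : Fin n → Set where
    here  : InSubtree p j j
    there : ∀ {k k′ s} → p k ≡ just (k′ , s) → InSubtree p j k′ → InSubtree p j k

  record IsPermutree (p : ParentMap) : Set where
    field
      slotInjective : ∀ i k s → p i ≡ just s → p k ≡ just s → i ≡ k
      acyclic       : ∀ i k s → p i ≡ just (k , s) → ¬ InSubtree p i k
      -- connected: exactly one node with an empty parent slot (the root)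
      uniqueRoot    : Σ (Fin n) (λ r → p r ≡ nothing × (∀ r′ → p r′ ≡ nothing → r′ ≡ r))
      leftSmaller   : ∀ i j s → p j ≡ just (i , s) → IsLeft (lookup δ i) s →
                        ∀ k → InSubtree p j k → k < i
      rightBigger   : ∀ i j s → p j ≡ just (i , s) → IsRight (lookup δ i) s →
                        ∀ k → InSubtree p j k → i < k

  record Permutree : Set where
    field
      parent      : ParentMap
      isPermutree : IsPermutree parent

  PermutreeSetoid : Setoid _ _
  PermutreeSetoid = record
    { Carrier = Permutree
    ; _≈_ = λ a b → ∀ k → Permutree.parent a k ≡ Permutree.parent b k
    ; isEquivalence = record
      { refl = λ k → refl
      ; sym = λ e k → sym (e k)
      ; trans = λ e₁ e₂ k → trans (e₁ k) (e₂ k) } }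

-- Directed multigraphs on vertices v_0..v_N given as edge lists
-- (tail , head) of natural numbers; integer d-flows.

Edges : Set
Edges = List (ℕ × ℕ)

module _ (E : Edges) where

  outflow : (Fin (length E) → ℕ) → ℕ → ℕ
  outflow f v = sum (map (λ e → if ⌊ proj₁ (L.lookup E e) ≟ v ⌋ then f e else 0)
                         (allFin (length E)))

  inflow : (Fin (length E) → ℕ) → ℕ → ℕ
  inflow f v = sum (map (λ e → if ⌊ proj₂ (L.lookup E e) ≟ v ⌋ then f e else 0)
                        (allFin (length E)))

  module _ (N : ℕ) (d : ℕ → ℤ) where

    IsFlow : (Fin (length E) → ℕ) → Set
    IsFlow f = ∀ (v : Fin (suc N)) → (+ outflow f (toℕ v)) - (+ inflow f (toℕ v)) ≡ d (toℕ v)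

    record Flow : Set where
      field
        flow   : Fin (length E) → ℕ
        isFlow : IsFlow flow

    FlowSetoid : Setoid _ _
    FlowSetoid = record
      { Carrier = Flow
      ; _≈_ = λ a b → ∀ e → Flow.flow a e ≡ Flow.flow b e
      ; isEquivalence = record
        { refl = λ e → refl
        ; sym = λ p e → sym (p e)
        ; trans = λ p q e → trans (p e) (q e) } }

-- For i ∈ [n] (i = toℕ k + 1, k : Fin n), the bump e^i_0 and dip e^i_1
-- go from v_{n-i} to v_{n+1-i}.  An M-move on (v_a, v_{a+1}) replaces it
-- by (v_0, v_{a+1}) and (v_a, v_n).

moveBump : Deco → Bool
moveBump U = true
moveBump X = true
moveBump _ = false

moveDip : Deco → Bool
moveDip D = true
moveDip X = true
moveDip _ = false

module _ (n : ℕ) where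

  edgeOrMoved : Bool → ℕ → Edges
  edgeOrMoved false a = (a , suc a) ∷ []
  edgeOrMoved true  a = (0 , suc a) ∷ (a , n) ∷ []

  edgesAt : Deco → Fin n → Edges
  edgesAt d k = edgeOrMoved (moveBump d) (n ∸ suc (toℕ k))
             ++ edgeOrMoved (moveDip d) (n ∸ suc (toℕ k))

Bic : ∀ {n} → Vec Deco n → Edges
Bic {n} δ = concatMap (λ k → edgesAt n (lookup δ k) k) (allFin n)

demand : ℕ → ℕ → ℤ
demand n zero = 0ℤ
demand n (suc v) = if ⌊ suc v ≟ n ⌋ then - (+ (n ∸ 1)) else 1ℤ

{-# OPTIONS --safe #-}

-- Both sets are in bijection with the same codes: vectors (i₁, …, i₍ₙ₋₁₎) of naturals in which
-- each entry i_k ranges over 0, …, s_k, where s_k is computed from the later entries.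
--
-- Trees: insert the nodes vₙ, vₙ₋₁, …, v₁ one at a time.  The node being inserted is the smallest
-- so far, so it lies in no right subtree and must go on the left spine (the chain of left children
-- starting at the root).  Its position among the s + 1 gaps of a spine with s nodes is the code
-- entry; the part of the spine below it hangs from its right (or only) child slot, so the new spine
-- has s + 1 nodes for the decoration I and i + 1 nodes for D.  Conversely v₁ always lies on the
-- spine, and deleting it recovers the smaller tree and the gap.
--
-- Flows: climb the oruga graph from v₀.  If c units enter vₐ from below, conservation with demand 1
-- sends c + 1 units out along the two edges of the level, and the code entry is the flow on the
-- bump, any of 0, …, c + 1.  For I both edges enter vₐ₊₁, which thus receives c + 1 units; for D the
-- dip is replaced by an edge into the sink and an edge out of v₀ that carries nothing (v₀ has
-- demand 0 and no inflow), so vₐ₊₁ receives exactly the bump.  Hence the flow entering the next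
-- vertex and the spine length minus one obey the same recursion.

module Submission where

open import Defs
open import Data.Nat as ℕ using (ℕ; zero; suc; z≤n; s≤s; _≤_; _<_; _∸_; _+_)
import Data.Nat.Properties as ℕₚ
import Data.Integer as ℤ
import Data.Integer.Properties as ℤₚ
open import Data.Fin as Fin using (Fin; zero; suc; toℕ)
open import Data.Fin.Properties as Finₚ using (suc-injective)
open import Data.Vec using (Vec; []; _∷_; lookup; map)
import Data.Vec.Properties as Vecₚ
open import Data.List as List using (List; []; _∷_; _++_; take; drop; length)
import Data.List.Properties as Listₚ
open import Data.Nat.ListAction using (sum)
open import Data.List.Relation.Unary.Any using (here; there)
open import Data.List.Relation.Unary.All as All using (All; []; _∷_)
open import Data.List.Membership.Propositional using (_∈_)
open import Data.List.Membership.Propositional.Properties using (∈-map⁺; ∈-++⁺ˡ; ∈-++⁺ʳ)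
open import Data.Maybe as Maybe using (Maybe; just; nothing)
open import Data.Maybe.Properties as Maybeₚ using (just-injective)
open import Data.Bool as Bool using (Bool; true; false; if_then_else_)
open import Data.Product using (Σ; _×_; _,_; proj₁; proj₂)
open import Data.Sum using (_⊎_; inj₁; inj₂)
open import Data.Unit using (⊤; tt)
open import Data.Empty using (⊥; ⊥-elim)
open import Relation.Nullary using (¬_; Dec; yes; no)
open import Relation.Nullary.Decidable using (⌊_⌋)
open import Relation.Binary.PropositionalEquality hiding (J)
open import Relation.Binary.Bundles using (Setoid)
open import Function.Base using (id; _∘_)
open import Function.Bundles using (Bijection; Inverse)
open import Function.Properties.Inverse using (Inverse⇒Bijection)
import Function.Construct.Composition as Composition
import Function.Construct.Identity as Identity

leftSlot : (d : DecoID) → ChildSlot d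
leftSlot I = tt
leftSlot D = left

rightSlot : (d : DecoID) → ChildSlot d
rightSlot I = tt
rightSlot D = right

¬IsLeft-rightSlot : ∀ d → ¬ IsLeft d (rightSlot d)
¬IsLeft-rightSlot I ()
¬IsLeft-rightSlot D ()

¬IsRight-leftSlot : ∀ d → ¬ IsRight d (leftSlot d)
¬IsRight-leftSlot I ()
¬IsRight-leftSlot D ()

¬IsRight⇒leftSlot : ∀ d (s : ChildSlot d) → ¬ IsRight d s → s ≡ leftSlot d
¬IsRight⇒leftSlot I s _ = refl
¬IsRight⇒leftSlot D left _ = refl
¬IsRight⇒leftSlot D right ¬r = ⊥-elim (¬r tt)

¬IsLeft⇒rightSlot : ∀ d (s : ChildSlot d) → ¬ IsLeft d s → s ≡ rightSlot d
¬IsLeft⇒rightSlot I s _ = refl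
¬IsLeft⇒rightSlot D right _ = refl
¬IsLeft⇒rightSlot D left ¬l = ⊥-elim (¬l tt)

-- The position of the left child of u; nothing (no u) stands for the root.
leftChildOf : ∀ {n} (δ : Vec DecoID n) → Maybe (Fin n) → Maybe (ParentPos δ)
leftChildOf δ nothing = nothing
leftChildOf δ (just u) = just (u , leftSlot (lookup δ u))

NotInRightSubtree : ∀ {n} (δ : Vec DecoID n) → ParentMap δ → Fin n → Set
NotInRightSubtree δ p j = ∀ y z s → p y ≡ just (z , s) → IsRight (lookup δ z) s → ¬ InSubtree δ p y j

nothing⊎just : ∀ {A : Set} (m : Maybe A) → (m ≡ nothing) ⊎ Σ A (λ a → m ≡ just a)
nothing⊎just nothing = inj₁ refl
nothing⊎just (just a) = inj₂ (a , refl)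

module _ {n} {δ : Vec DecoID n} where

  leftChildOf-just : ∀ {up : Maybe (Fin n)} {u s} → leftChildOf δ up ≡ just (u , s) → up ≡ just u
  leftChildOf-just {just u} refl = refl

  leftChildOf-injective : ∀ {a b} → leftChildOf δ a ≡ leftChildOf δ b → a ≡ b
  leftChildOf-injective {nothing} {nothing} e = refl
  leftChildOf-injective {just a} {just .a} refl = refl

  inSubtree-parent : ∀ {p : ParentMap δ} {x′ x y s} →
                     InSubtree δ p x′ y → p x′ ≡ just (x , s) → InSubtree δ p x y
  inSubtree-parent here e = there e here
  inSubtree-parent (there e′ r) e = there e′ (inSubtree-parent r e)

  module _ {p p′ : ParentMap δ} (p≗p′ : ∀ x → p x ≡ p′ x) where

    inSubtree-resp : ∀ {j k} → InSubtree δ p j k → InSubtree δ p′ j k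
    inSubtree-resp here = here
    inSubtree-resp (there e r) = there (trans (sym (p≗p′ _)) e) (inSubtree-resp r)

  module _ {p p′ : ParentMap δ} (p≗p′ : ∀ x → p x ≡ p′ x) where

    private
      back : ∀ {j k} → InSubtree δ p′ j k → InSubtree δ p j k
      back = inSubtree-resp (λ x → sym (p≗p′ x))

    notInRight-resp : ∀ {j} → NotInRightSubtree δ p j → NotInRightSubtree δ p′ j
    notInRight-resp nr y z s e r rr = nr y z s (trans (p≗p′ y) e) r (back rr)

    isPermutree-resp : IsPermutree δ p → IsPermutree δ p′
    isPermutree-resp P = record
      { slotInjective = λ i k s e₁ e₂ → slotInjective i k s (trans (p≗p′ i) e₁) (trans (p≗p′ k) e₂)
      ; acyclic = λ i k s e r → acyclic i k s (trans (p≗p′ i) e) (back r)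
      ; uniqueRoot = let (r , er , u) = uniqueRoot in r , trans (sym (p≗p′ r)) er , λ r′ e → u r′
          (trans (p≗p′ r′) e)
      ; leftSmaller = λ i j s e l k r → leftSmaller i j s (trans (p≗p′ j) e) l k (back r)
      ; rightBigger = λ i j s e l k r → rightBigger i j s (trans (p≗p′ j) e) l k (back r)
      }
      where open IsPermutree P

-- Following parents from a node, two of the first N + 1 nodes coincide (pigeonhole),
-- which puts a node into the subtree of its own child.
module _ {N} {δ : Vec DecoID N} (p : ParentMap δ)
         (acyclic : ∀ i k s → p i ≡ just (k , s) → ¬ InSubtree δ p i k) where

  private
    module Rootless (rootless : ∀ r → p r ≢ nothing) where

      parentPos : ∀ x → Σ (ParentPos δ) λ pp → p x ≡ just pp
      parentPos x with p x in eq
      ... | nothing = ⊥-elim (rootless x eq)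
      ... | just pp = pp , refl

      parent : Fin N → Fin N
      parent x = proj₁ (proj₁ (parentPos x))

      ancestor : ℕ → Fin N → Fin N
      ancestor zero x = x
      ancestor (suc m) x = ancestor m (parent x)

      ancestor-+ : ∀ m k x → ancestor (m + k) x ≡ ancestor k (ancestor m x)
      ancestor-+ zero k x = refl
      ancestor-+ (suc m) k x = ancestor-+ m k (parent x)

      ancestor-InSubtree : ∀ m x → InSubtree δ p (ancestor m x) x
      ancestor-InSubtree zero x = here
      ancestor-InSubtree (suc m) x = there (proj₂ (parentPos x)) (ancestor-InSubtree m (parent x))

      absurd : Fin N → ⊥
      absurd x₀ with Finₚ.pigeonhole (ℕₚ.n<1+n N) (λ t → ancestor (toℕ t) x₀)
      ... | i , j , i<j , eq with ℕₚ.m≤n⇒∃[o]m+o≡n i<j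
      ... | o , eo = acyclic a (parent a) (proj₂ (proj₁ (parentPos a))) (proj₂ (parentPos a)) a∈parent
        where
        a = ancestor (toℕ i) x₀
        ancestor-j : ancestor (toℕ j) x₀ ≡ ancestor o (parent a)
        ancestor-j = trans (cong (λ t → ancestor t x₀) (trans (sym eo) (sym (ℕₚ.+-suc (toℕ i) o))))
                           (ancestor-+ (toℕ i) (suc o) x₀)
        a∈parent : InSubtree δ p a (parent a)
        a∈parent = subst (λ t → InSubtree δ p t (parent a)) (sym (trans eq ancestor-j))
                         (ancestor-InSubtree o (parent a))

    isRoot? : ∀ x → Dec (p x ≡ nothing)
    isRoot? x with p x
    ... | nothing = yes refl
    ... | just _ = no (λ ())

  acyclic⇒root : Fin N → Σ (Fin N) λ r → p r ≡ nothing
  acyclic⇒root x₀ with Finₚ.any? isRoot?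
  ... | yes r = r
  ... | no ¬r = ⊥-elim (Rootless.absurd (λ r e → ¬r (r , e)) x₀)

Occupies : ∀ {n} (δ : Vec DecoID n) → ParentMap δ → Maybe (Fin n) → Maybe (Fin n) → Set
Occupies δ p up dn = ∀ x → (dn ≡ just x → p x ≡ leftChildOf δ up) ×
    (p x ≡ leftChildOf δ up → dn ≡ just x)

occupies-resp : ∀ {n} {δ : Vec DecoID n} {p p₂ up dn} → (∀ k → p k ≡ p₂ k) → Occupies δ p up dn →
    Occupies δ p₂ up dn
occupies-resp eq occ x = (λ e → trans (sym (eq x)) (proj₁ (occ x) e)) , (λ e → proj₂ (occ x) (trans (eq x) e))

module Insert {n} (d : DecoID) (δ′ : Vec DecoID n) where

  δ : Vec DecoID (suc n)
  δ = d ∷ δ′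

  shiftPos : Maybe (ParentPos δ′) → Maybe (ParentPos δ)
  shiftPos nothing = nothing
  shiftPos (just (j , s)) = just (suc j , s)

  ≟-Maybe : (a b : Maybe (Fin n)) → Dec (a ≡ b)
  ≟-Maybe = Maybeₚ.≡-dec Fin._≟_

  -- Node 0 becomes the left child of up (the root if up = nothing), and dn, the former occupant
  -- of that position, moves into the right (or only) child slot of node 0.
  insert : ParentMap δ′ → Maybe (Fin n) → Maybe (Fin n) → ParentMap δ
  insert p up dn zero = shiftPos (leftChildOf δ′ up)
  insert p up dn (suc k) with ≟-Maybe dn (just k)
  ... | yes _ = just (zero , rightSlot d)
  ... | no _ = shiftPos (p k)

  shiftPos-injective : ∀ {a b} → shiftPos a ≡ shiftPos b → a ≡ b
  shiftPos-injective {nothing} {nothing} e = refl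
  shiftPos-injective {just (j , s)} {just (.j , .s)} refl = refl

  shiftPos-leftChildOf⁻¹ : ∀ {up : Maybe (Fin n)} {K′ s} → shiftPos (leftChildOf δ′ up) ≡ just (K′ , s) →
      Σ (Fin n) λ u → up ≡ just u × K′ ≡ suc u
  shiftPos-leftChildOf⁻¹ {just u} refl = u , refl , refl

  shiftPos-suc⁻¹ : ∀ {x i s} → shiftPos x ≡ just (suc i , s) → x ≡ just (i , s)
  shiftPos-suc⁻¹ {just (j , s)} refl = refl

  shiftPos≢zero : ∀ {x s} → shiftPos x ≡ just (zero , s) → ⊥
  shiftPos≢zero {just (j , s)} ()

  shiftPos-nothing⁻¹ : ∀ {x} → shiftPos x ≡ nothing → x ≡ nothing
  shiftPos-nothing⁻¹ {nothing} e = refl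

  shiftPos-just⁻¹ : ∀ {x K′ s} → shiftPos x ≡ just (K′ , s) →
      Σ (ParentPos δ′) λ pp → x ≡ just pp × K′ ≡ suc (proj₁ pp)
  shiftPos-just⁻¹ {just (j , s)} refl = (j , s) , refl , refl

  module Inserted (p : ParentMap δ′) (up dn : Maybe (Fin n)) where
    q = insert p up dn

    insert-occupant : ∀ k → dn ≡ just k → q (suc k) ≡ just (zero , rightSlot d)
    insert-occupant k e with ≟-Maybe dn (just k)
    ... | yes _ = refl
    ... | no ne = ⊥-elim (ne e)

    insert-other : ∀ k → dn ≢ just k → q (suc k) ≡ shiftPos (p k)
    insert-other k ne with ≟-Maybe dn (just k)
    ... | yes e = ⊥-elim (ne e)
    ... | no _ = refl

    occupant? : ∀ k → (dn ≡ just k) ⊎ (dn ≢ just k)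
    occupant? k with ≟-Maybe dn (just k)
    ... | yes e = inj₁ e
    ... | no ne = inj₂ ne

    module Occupied (occ : Occupies δ′ p up dn) where

      lift-InSubtree : ∀ {j k} → InSubtree δ′ p j k → InSubtree δ q (suc j) (suc k)
      lift-InSubtree here = here
      lift-InSubtree {j} (there {k} {k′} {s} e r) with occupant? k
      ... | inj₂ ne = there (trans (insert-other k ne) (cong shiftPos e)) (lift-InSubtree r)
      ... | inj₁ y with leftChildOf-just (trans (sym (proj₁ (occ k) y)) e)
      ... | refl = there (insert-occupant k y) (there refl (lift-InSubtree r))

      LoweredSubtree : Fin n → Fin (suc n) → Set
      LoweredSubtree j zero = Σ (Fin n) λ u → up ≡ just u × InSubtree δ′ p j u
      LoweredSubtree j (suc k) = InSubtree δ′ p j k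

      lower-InSubtree : ∀ {j K} → InSubtree δ q (suc j) K → LoweredSubtree j K
      lower-InSubtree here = here
      lower-InSubtree {j} (there {zero} {K′} e r) with shiftPos-leftChildOf⁻¹ e
      ... | u , eu , refl = u , eu , lower-InSubtree r
      lower-InSubtree {j} (there {suc k} {K′} e r) with occupant? k
      ... | inj₁ y with trans (sym (insert-occupant k y)) e
      ... | refl with lower-InSubtree r
      ... | u , refl , rr = there (proj₁ (occ k) y) rr
      lower-InSubtree {j} (there {suc k} {K′} e r) | inj₂ ne with shiftPos-just⁻¹
          (trans (sym (insert-other k ne)) e)
      ... | (k″ , s″) , ek , refl = there ek (lower-InSubtree r)

      BelowNew : Fin (suc n) → Set
      BelowNew zero = ⊤
      BelowNew (suc k) = Σ (Fin n) λ x → dn ≡ just x × InSubtree δ′ p x k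

      below-new : ∀ {K} → InSubtree δ q zero K → BelowNew K
      below-new here = tt
      below-new (there {zero} e r) = tt
      below-new (there {suc k} e r) with occupant? k
      ... | inj₁ y with trans (sym (insert-occupant k y)) e
      ... | refl = k , y , here
      below-new (there {suc k} e r) | inj₂ ne with shiftPos-just⁻¹ (trans (sym (insert-other k ne)) e)
      ... | (k″ , s″) , ek , refl with below-new r
      ... | x , ex , rr = x , ex , there ek rr

      insert-new : ∀ {u} → up ≡ just u → q zero ≡ just (suc u , leftSlot (lookup δ′ u))
      insert-new e = cong (λ m → shiftPos (leftChildOf δ′ m)) e

      module Forward (P : IsPermutree δ′ p)
          (leftOf-notInRight : ∀ u → up ≡ just u → NotInRightSubtree δ′ p u) where
        open IsPermutree P

        occupant-parent : ∀ {x u} → dn ≡ just x → up ≡ just u → p x ≡ just (u , leftSlot (lookup δ′ u))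
        occupant-parent y eu = trans (proj₁ (occ _) y) (cong (leftChildOf δ′) eu)

        q-slotInjective : ∀ i k s → q i ≡ just s → q k ≡ just s → i ≡ k
        q-slotInjective zero zero s e1 e2 = refl
        q-slotInjective zero (suc k) s e1 e2 with occupant? k
        ... | inj₁ y with shiftPos-leftChildOf⁻¹ (trans e1 (trans (sym e2) (insert-occupant k y)))
        ... | _ , _ , ()
        q-slotInjective zero (suc k) s e1 e2 | inj₂ ne = ⊥-elim
            (ne (proj₂ (occ k) (shiftPos-injective
            (trans (trans (sym (insert-other k ne)) e2) (sym e1)))))
        q-slotInjective (suc i) zero s e1 e2 with occupant? i
        ... | inj₁ y with shiftPos-leftChildOf⁻¹ (trans e2 (trans (sym e1) (insert-occupant i y)))
        ... | _ , _ , ()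
        q-slotInjective (suc i) zero s e1 e2 | inj₂ ne = ⊥-elim
            (ne (proj₂ (occ i) (shiftPos-injective
            (trans (trans (sym (insert-other i ne)) e1) (sym e2)))))
        q-slotInjective (suc i) (suc k) s e1 e2 with occupant? i | occupant? k
        ... | inj₁ y1 | inj₁ y2 = cong suc (just-injective (trans (sym y1) y2))
        ... | inj₁ y1 | inj₂ n2 = ⊥-elim
            (shiftPos≢zero (trans (sym (insert-other k n2))
            (trans e2 (trans (sym e1) (insert-occupant i y1)))))
        ... | inj₂ n1 | inj₁ y2 = ⊥-elim
            (shiftPos≢zero (trans (sym (insert-other i n1))
            (trans e1 (trans (sym e2) (insert-occupant k y2)))))
        ... | inj₂ n1 | inj₂ n2 with shiftPos-just⁻¹ (trans (sym (insert-other i n1)) e1)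
        ... | pp , epi , _ = cong suc (slotInjective i k pp epi
            (trans (shiftPos-injective (trans (sym (insert-other k n2))
            (trans e2 (trans (sym e1) (insert-other i n1))))) epi))

        q-acyclic : ∀ i k s → q i ≡ just (k , s) → ¬ InSubtree δ q i k
        q-acyclic zero k s e r with shiftPos-leftChildOf⁻¹ e
        ... | u , eu , refl with below-new r
        ... | x , ex , rr = acyclic x u _ (occupant-parent ex eu) rr
        q-acyclic (suc i) k s e r with occupant? i
        ... | inj₁ y with trans (sym (insert-occupant i y)) e
        ... | refl with lower-InSubtree r
        ... | u , eu , rr = acyclic i u _ (occupant-parent y eu) rr
        q-acyclic (suc i) k s e r | inj₂ ne with shiftPos-just⁻¹ (trans (sym (insert-other i ne)) e)
        ... | (k″ , s″) , ek , refl = acyclic i k″ s″ ek (lower-InSubtree r)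

        q-uniqueRoot : Σ (Fin (suc n)) (λ r → q r ≡ nothing × (∀ r′ → q r′ ≡ nothing → r′ ≡ r))
        q-uniqueRoot with nothing⊎just up
        ... | inj₁ eu = zero , cong (λ m → shiftPos (leftChildOf δ′ m)) eu , uniq
          where
          uniq : ∀ r′ → q r′ ≡ nothing → r′ ≡ zero
          uniq zero e = refl
          uniq (suc r) e with occupant? r
          ... | inj₁ y with trans (sym (insert-occupant r y)) e
          ... | ()
          uniq (suc r) e | inj₂ ne = ⊥-elim
              (ne (proj₂ (occ r) (trans (shiftPos-nothing⁻¹ (trans (sym (insert-other r ne)) e))
              (cong (leftChildOf δ′) (sym eu)))))
        ... | inj₂ (u , eu) = suc r0 , qr0 , uniq
          where
          r0 = proj₁ uniqueRoot
          pr0 = proj₁ (proj₂ uniqueRoot)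
          qr0 : q (suc r0) ≡ nothing
          qr0 with occupant? r0
          ... | inj₁ y with trans (sym (occupant-parent y eu)) pr0
          ... | ()
          qr0 | inj₂ ne = trans (insert-other r0 ne) (cong shiftPos pr0)
          uniq : ∀ r′ → q r′ ≡ nothing → r′ ≡ suc r0
          uniq zero e with trans (sym (insert-new eu)) e
          ... | ()
          uniq (suc r) e with occupant? r
          ... | inj₁ y with trans (sym (insert-occupant r y)) e
          ... | ()
          uniq (suc r) e | inj₂ ne = cong suc
              (proj₂ (proj₂ uniqueRoot) r (shiftPos-nothing⁻¹ (trans (sym (insert-other r ne)) e)))

        q-leftSmaller : ∀ i j s → q j ≡ just (i , s) → IsLeft (lookup δ i) s → ∀ k → InSubtree δ q j k →
            k Fin.< i
        q-leftSmaller zero zero s e l k r with shiftPos-leftChildOf⁻¹ e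
        ... | _ , _ , ()
        q-leftSmaller zero (suc j) s e l k r with occupant? j
        ... | inj₁ y with trans (sym (insert-occupant j y)) e
        ... | refl = ⊥-elim (¬IsLeft-rightSlot d l)
        q-leftSmaller zero (suc j) s e l k r | inj₂ ne = ⊥-elim
            (shiftPos≢zero (trans (sym (insert-other j ne)) e))
        q-leftSmaller (suc i) zero s e l zero r = s≤s z≤n
        q-leftSmaller (suc i) zero s e l (suc k) r with shiftPos-leftChildOf⁻¹ e
        ... | u , eu , refl with trans (sym (insert-new eu)) e
        ... | refl with below-new r
        ... | x , ex , rr = s≤s (leftSmaller u x _ (occupant-parent ex eu) l k rr)
        q-leftSmaller (suc i) (suc j) s e l zero r = s≤s z≤n
        q-leftSmaller (suc i) (suc j) s e l (suc k) r with occupant? j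
        ... | inj₁ y with trans (sym (insert-occupant j y)) e
        ... | ()
        q-leftSmaller (suc i) (suc j) s e l (suc k) r | inj₂ ne = s≤s
            (leftSmaller i j s (shiftPos-suc⁻¹ (trans (sym (insert-other j ne)) e)) l k
            (lower-InSubtree r))

        q-rightBigger : ∀ i j s → q j ≡ just (i , s) → IsRight (lookup δ i) s → ∀ k → InSubtree δ q j k →
            i Fin.< k
        q-rightBigger zero zero s e l k r with shiftPos-leftChildOf⁻¹ e
        ... | _ , _ , ()
        q-rightBigger zero (suc j) s e l zero r with occupant? j
        ... | inj₁ y with lower-InSubtree r
        ... | u , eu , rr = ⊥-elim (acyclic j u _ (occupant-parent y eu) rr)
        q-rightBigger zero (suc j) s e l zero r | inj₂ ne = ⊥-elim
            (shiftPos≢zero (trans (sym (insert-other j ne)) e))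
        q-rightBigger zero j s e l (suc k) r = s≤s z≤n
        q-rightBigger (suc i) zero s e l k r with shiftPos-leftChildOf⁻¹ e
        ... | u , eu , refl with trans (sym (insert-new eu)) e
        ... | refl = ⊥-elim (¬IsRight-leftSlot (lookup δ′ u) l)
        q-rightBigger (suc i) (suc j) s e l k r with occupant? j
        ... | inj₁ y with trans (sym (insert-occupant j y)) e
        ... | ()
        q-rightBigger (suc i) (suc j) s e l zero r | inj₂ ne with lower-InSubtree r
        ... | u , eu , rr = ⊥-elim (leftOf-notInRight u eu j i s
            (shiftPos-suc⁻¹ (trans (sym (insert-other j ne)) e)) l rr)
        q-rightBigger (suc i) (suc j) s e l (suc k) r | inj₂ ne = s≤s
            (rightBigger i j s (shiftPos-suc⁻¹ (trans (sym (insert-other j ne)) e)) l k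
            (lower-InSubtree r))

        insert-isPermutree : IsPermutree δ q
        insert-isPermutree = record { slotInjective = q-slotInjective ; acyclic = q-acyclic ; uniqueRoot
            = q-uniqueRoot ; leftSmaller = q-leftSmaller ; rightBigger = q-rightBigger }

      module Backward (Qp : IsPermutree δ q) (x₀ : Fin n) where
        open IsPermutree Qp

        p-slotInjective : ∀ i k s → p i ≡ just s → p k ≡ just s → i ≡ k
        p-slotInjective i k s e1 e2 with occupant? i
        ... | inj₁ y = just-injective (trans (sym y)
            (proj₂ (occ k) (trans e2 (trans (sym e1) (proj₁ (occ i) y)))))
        ... | inj₂ ni with occupant? k
        ... | inj₁ yk = ⊥-elim (ni (proj₂ (occ i) (trans e1 (trans (sym e2) (proj₁ (occ k) yk)))))
        ... | inj₂ nk = suc-injective (slotInjective (suc i) (suc k) _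
            (trans (insert-other i ni) (cong shiftPos e1))
            (trans (insert-other k nk) (cong shiftPos e2)))

        p-acyclic : ∀ i k s → p i ≡ just (k , s) → ¬ InSubtree δ′ p i k
        p-acyclic i k s e r with occupant? i
        ... | inj₂ ni = acyclic (suc i) (suc k) s (trans (insert-other i ni) (cong shiftPos e))
            (lift-InSubtree r)
        ... | inj₁ y with leftChildOf-just (trans (sym (proj₁ (occ i) y)) e)
        ... | eu = acyclic zero (suc k) _ (insert-new eu)
            (inSubtree-parent (lift-InSubtree r) (insert-occupant i y))

        p-uniqueRoot : Σ (Fin n) (λ r → p r ≡ nothing × (∀ r′ → p r′ ≡ nothing → r′ ≡ r))
        p-uniqueRoot with acyclic⇒root p p-acyclic x₀
        ... | r , er = r , er , uniq
          where
          uniq : ∀ r′ → p r′ ≡ nothing → r′ ≡ r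
          uniq r′ e with nothing⊎just up
          ... | inj₁ eu = just-injective
              (trans (sym (proj₂ (occ r′) (trans e (cong (leftChildOf δ′) (sym eu)))))
              (proj₂ (occ r) (trans er (cong (leftChildOf δ′) (sym eu)))))
          ... | inj₂ (u , eu) with occupant? r′ | occupant? r
          ... | inj₁ y | _ with trans (sym e) (trans (proj₁ (occ r′) y) (cong (leftChildOf δ′) eu))
          ... | ()
          uniq r′ e | inj₂ (u , eu) | _ | inj₁ y with trans (sym er)
              (trans (proj₁ (occ r) y) (cong (leftChildOf δ′) eu))
          ... | ()
          uniq r′ e | inj₂ (u , eu) | inj₂ n1 | inj₂ n2 =
            suc-injective (trans (proj₂ (proj₂ uniqueRoot) (suc r′) (trans (insert-other r′ n1) (cong shiftPos e)))
                                 (sym (proj₂ (proj₂ uniqueRoot) (suc r) (trans (insert-other r n2) (cong shiftPos er)))))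

        p-leftSmaller : ∀ i j s → p j ≡ just (i , s) → IsLeft (lookup δ′ i) s → ∀ k → InSubtree δ′ p j k
            → k Fin.< i
        p-leftSmaller i j s e l k r with occupant? j
        ... | inj₂ nj = ℕ.≤-pred (leftSmaller (suc i) (suc j) s
            (trans (insert-other j nj) (cong shiftPos e)) l (suc k) (lift-InSubtree r))
        ... | inj₁ y with leftChildOf-just (trans (sym (proj₁ (occ j) y)) e)
        ... | eu with trans (sym (cong (leftChildOf δ′) eu)) (trans (sym (proj₁ (occ j) y)) e)
        ... | refl = ℕ.≤-pred (leftSmaller (suc i) zero _ (insert-new eu) l (suc k)
            (inSubtree-parent (lift-InSubtree r) (insert-occupant j y)))

        p-rightBigger : ∀ i j s → p j ≡ just (i , s) → IsRight (lookup δ′ i) s → ∀ k → InSubtree δ′ p j k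
            → i Fin.< k
        p-rightBigger i j s e l k r with occupant? j
        ... | inj₂ nj = ℕ.≤-pred (rightBigger (suc i) (suc j) s
            (trans (insert-other j nj) (cong shiftPos e)) l (suc k) (lift-InSubtree r))
        ... | inj₁ y with leftChildOf-just (trans (sym (proj₁ (occ j) y)) e)
        ... | eu with trans (sym (cong (leftChildOf δ′) eu)) (trans (sym (proj₁ (occ j) y)) e)
        ... | refl = ⊥-elim (¬IsRight-leftSlot (lookup δ′ i) l)

        insert-isPermutree⁻¹ : IsPermutree δ′ p
        insert-isPermutree⁻¹ = record { slotInjective = p-slotInjective ; acyclic = p-acyclic ;
            uniqueRoot = p-uniqueRoot ; leftSmaller = p-leftSmaller ; rightBigger = p-rightBigger }

      leftChildOf-notInRight : IsPermutree δ q → ∀ u → up ≡ just u → NotInRightSubtree δ′ p u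
      leftChildOf-notInRight Qp u eu y z s e isR r with occupant? y
      ... | inj₁ y′ with trans (sym (trans (proj₁ (occ y) y′) (cong (leftChildOf δ′) eu))) e
      ... | refl = ¬IsRight-leftSlot (lookup δ′ u) isR
      leftChildOf-notInRight Qp u eu y z s e isR r | inj₂ ny with IsPermutree.rightBigger Qp (suc z)
          (suc y) s (trans (insert-other y ny) (cong shiftPos e)) isR zero
          (there (insert-new eu) (lift-InSubtree r))
      ... | ()

  unshiftParent : Maybe (ParentPos δ) → Maybe (Fin n)
  unshiftParent (just (suc u , _)) = just u
  unshiftParent _ = nothing

  unshiftPos : Maybe (ParentPos δ) → Maybe (ParentPos δ′)
  unshiftPos (just (suc j , s)) = just (j , s)
  unshiftPos _ = nothing

  -- A node in a child slot of the removed node 0 takes over the parent position of 0.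
  removePos : Maybe (ParentPos δ) → Maybe (ParentPos δ) → Maybe (ParentPos δ′)
  removePos (just (zero , _)) pz = unshiftPos pz
  removePos x _ = unshiftPos x

  underNew : Maybe (ParentPos δ) → Bool
  underNew (just (zero , _)) = true
  underNew _ = false

  remove : ParentMap δ → ParentMap δ′
  remove p k = removePos (p (suc k)) (p zero)

  rightChildOfNew : ParentMap δ → Maybe (Fin n)
  rightChildOfNew p with Finₚ.any? (λ x → underNew (p (suc x)) Bool.≟ true)
  ... | yes (x , _) = just x
  ... | no _ = nothing

  rightChildOfNew-spec : ∀ p → (Σ (Fin n) λ x → rightChildOfNew p ≡ just x × underNew (p (suc x)) ≡ true)
      ⊎ (rightChildOfNew p ≡ nothing × (∀ x → underNew (p (suc x)) ≢ true))
  rightChildOfNew-spec p with Finₚ.any? (λ x → underNew (p (suc x)) Bool.≟ true)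
  ... | yes (x , ex) = inj₁ (x , refl , ex)
  ... | no nx = inj₂ (refl , λ x e → nx (x , e))

  module Decompose (p : ParentMap δ) (Pp : IsPermutree δ p) where
    open IsPermutree Pp
    p′ = remove p
    up = unshiftParent (p zero)
    dn = rightChildOfNew p

    new-not-own-child : ∀ {s} → p zero ≢ just (zero , s)
    new-not-own-child e = acyclic zero zero _ e here

    new-in-leftSlot : ∀ {u s} → p zero ≡ just (suc u , s) →
        p zero ≡ just (suc u , leftSlot (lookup δ′ u))
    new-in-leftSlot {u} {s} e = trans e
        (cong (λ t → just (suc u , t))
        (¬IsRight⇒leftSlot (lookup δ′ u) s
        (λ isR → ℕₚ.n≮0 (rightBigger (suc u) zero s e isR zero here))))

    rightSlot-of-new : ∀ {k s} → p (suc k) ≡ just (zero , s) → p (suc k) ≡ just (zero , rightSlot d)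
    rightSlot-of-new {k} {s} e = trans e
        (cong (λ t → just (zero , t)) (¬IsLeft⇒rightSlot d s
        (λ isL → ℕₚ.n≮0 (leftSmaller zero (suc k) s e isL (suc k) here))))

    underNew-true : ∀ {x} → underNew x ≡ true → Σ (ChildSlot d) λ s → x ≡ just (zero , s)
    underNew-true {just (zero , s)} e = s , refl

    rightChildOfNew-sound : ∀ {x} → dn ≡ just x → p (suc x) ≡ just (zero , rightSlot d)
    rightChildOfNew-sound {x} e with rightChildOfNew-spec p
    ... | inj₁ (x′ , e′ , ez) with trans (sym e′) e
    ... | refl = rightSlot-of-new (proj₂ (underNew-true ez))
    rightChildOfNew-sound {x} e | inj₂ (e′ , _) with trans (sym e′) e
    ... | ()

    rightChildOfNew-complete : ∀ {x s} → p (suc x) ≡ just (zero , s) → dn ≡ just x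
    rightChildOfNew-complete {x} e with rightChildOfNew-spec p
    ... | inj₁ (x′ , e′ , ez) = trans e′
        (cong just (suc-injective (slotInjective (suc x′) (suc x) _
        (rightSlot-of-new (proj₂ (underNew-true ez))) (rightSlot-of-new e))))
    ... | inj₂ (_ , nx) = ⊥-elim (nx x (cong underNew e))

    insert-remove : ∀ K → insert p′ up dn K ≡ p K
    insert-remove zero with p zero in e
    ... | nothing = refl
    ... | just (zero , s) = ⊥-elim (new-not-own-child e)
    ... | just (suc u , s) with trans (sym e) (new-in-leftSlot e)
    ... | refl = refl
    insert-remove (suc k) with Inserted.occupant? p′ up dn k
    ... | inj₁ y = trans (Inserted.insert-occupant p′ up dn k y) (sym (rightChildOfNew-sound y))
    ... | inj₂ ny = trans (Inserted.insert-other p′ up dn k ny) (shift-other ny)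
      where
      shift-other : dn ≢ just k → shiftPos (p′ k) ≡ p (suc k)
      shift-other ny with p (suc k) in e
      ... | nothing = refl
      ... | just (zero , s) = ⊥-elim (ny (rightChildOfNew-complete e))
      ... | just (suc j , s) = refl

    remove-occupies : Occupies δ′ p′ up dn
    remove-occupies x = occupant⇒leftChild , leftChild⇒occupant
      where
      occupant⇒leftChild : dn ≡ just x → p′ x ≡ leftChildOf δ′ up
      occupant⇒leftChild y rewrite rightChildOfNew-sound y with p zero in e
      ... | nothing = refl
      ... | just (zero , s) = refl
      ... | just (suc u , s) with trans (sym e) (new-in-leftSlot e)
      ... | refl = refl
      leftChild⇒occupant : p′ x ≡ leftChildOf δ′ up → dn ≡ just x
      leftChild⇒occupant eq with p (suc x) in e
      ... | just (zero , s) = rightChildOfNew-complete e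
      ... | nothing with p zero in e0
      ... | nothing with trans (proj₂ (proj₂ uniqueRoot) (suc x) e)
          (sym (proj₂ (proj₂ uniqueRoot) zero e0))
      ... | ()
      leftChild⇒occupant eq | nothing | just (zero , s) = ⊥-elim (new-not-own-child e0)
      leftChild⇒occupant eq | nothing | just (suc u , s) with eq
      ... | ()
      leftChild⇒occupant eq | just (suc j , s) with p zero in e0
      leftChild⇒occupant eq | just (suc j , s) | nothing with eq
      ... | ()
      leftChild⇒occupant eq | just (suc j , s) | just (zero , s0) with eq
      ... | ()
      leftChild⇒occupant eq | just (suc j , s) | just (suc u , s0) with trans (sym e0) (new-in-leftSlot e0) | eq
      ... | refl | refl with slotInjective zero (suc x) _ e0 e
      ... | ()

  unshiftPos-shiftPos : ∀ x → unshiftPos (shiftPos x) ≡ x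
  unshiftPos-shiftPos nothing = refl
  unshiftPos-shiftPos (just (j , s)) = refl

  removePos-shiftPos : ∀ x pz → removePos (shiftPos x) pz ≡ x
  removePos-shiftPos nothing pz = refl
  removePos-shiftPos (just (j , s)) pz = refl

  remove-insert : ∀ p up dn → Occupies δ′ p up dn → ∀ k → remove (insert p up dn) k ≡ p k
  remove-insert p up dn occ k with Inserted.occupant? p up dn k
  ... | inj₁ y rewrite Inserted.insert-occupant p up dn k y = trans
      (unshiftPos-shiftPos (leftChildOf δ′ up)) (sym (proj₁ (occ k) y))
  ... | inj₂ ny rewrite Inserted.insert-other p up dn k ny = removePos-shiftPos (p k) _

  insert-resp : ∀ {p p₂} up dn → (∀ k → p k ≡ p₂ k) → ∀ K → insert p up dn K ≡ insert p₂ up dn K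
  insert-resp up dn eq zero = refl
  insert-resp {p} {p₂} up dn eq (suc k) with Inserted.occupant? p up dn k
  ... | inj₁ y = trans (Inserted.insert-occupant p up dn k y)
      (sym (Inserted.insert-occupant p₂ up dn k y))
  ... | inj₂ ny = trans (Inserted.insert-other p up dn k ny)
      (trans (cong shiftPos (eq k)) (sym (Inserted.insert-other p₂ up dn k ny)))

-- Gap i of a list lies just after its first i elements; aboveGap and belowGap give its
-- neighbours, where the list continues upwards with prev.
aboveGap : ∀ {A : Set} → Maybe A → List A → ℕ → Maybe A
aboveGap prev ss zero = prev
aboveGap prev [] (suc i) = prev
aboveGap prev (x ∷ xs) (suc i) = aboveGap (just x) xs i

belowGap : ∀ {A : Set} → List A → ℕ → Maybe A
belowGap [] _ = nothing
belowGap (x ∷ xs) zero = just x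
belowGap (x ∷ xs) (suc i) = belowGap xs i

spineTail : ∀ {n} → DecoID → List (Fin n) → List (Fin (suc n))
spineTail I xs = List.map suc xs
spineTail D xs = []

insertSpine : ∀ {n} → DecoID → List (Fin n) → ℕ → List (Fin (suc n))
insertSpine d ss i = List.map suc (take i ss) ++ zero ∷ spineTail d (drop i ss)

module _ {n} (δ : Vec DecoID n) (p : ParentMap δ) where
  data LeftChain : Maybe (Fin n) → List (Fin n) → Set where
    nil : ∀ {prev} → (∀ x → p x ≢ leftChildOf δ prev) → LeftChain prev []
    cons : ∀ {prev x xs} → p x ≡ leftChildOf δ prev → LeftChain (just x) xs → LeftChain prev (x ∷ xs)

record Spine {n} (δ : Vec DecoID n) (p : ParentMap δ) (ss : List (Fin n)) : Set where
  field
    isPermutree : IsPermutree δ p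
    leftChain   : LeftChain δ p nothing ss
    complete    : ∀ j → NotInRightSubtree δ p j → j ∈ ss

aboveGap-∈ : ∀ {A : Set} {x : A} xs i {y} → aboveGap (just x) xs i ≡ just y → y ≡ x ⊎ y ∈ xs
aboveGap-∈ xs zero refl = inj₁ refl
aboveGap-∈ [] (suc i) refl = inj₁ refl
aboveGap-∈ (w ∷ ws) (suc i) e with aboveGap-∈ ws i e
... | inj₁ refl = inj₂ (here refl)
... | inj₂ m = inj₂ (there m)

aboveGap-root-∈ : ∀ {A : Set} ss i {u : A} → aboveGap nothing ss i ≡ just u → u ∈ ss
aboveGap-root-∈ [] zero ()
aboveGap-root-∈ [] (suc i) ()
aboveGap-root-∈ (x ∷ xs) zero ()
aboveGap-root-∈ (x ∷ xs) (suc i) e with aboveGap-∈ xs i e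
... | inj₁ refl = here refl
... | inj₂ m = there m

aboveGap-just : ∀ {A : Set} (x : A) xs i → Σ A λ y → aboveGap (just x) xs i ≡ just y
aboveGap-just x xs zero = x , refl
aboveGap-just x [] (suc i) = x , refl
aboveGap-just x (w ∷ ws) (suc i) = aboveGap-just w ws i

belowGap-∈ : ∀ {A : Set} (xs : List A) i {y} → belowGap xs i ≡ just y → y ∈ xs
belowGap-∈ (x ∷ xs) zero refl = here refl
belowGap-∈ (x ∷ xs) (suc i) e = there (belowGap-∈ xs i e)

belowGap-drop : ∀ {A : Set} (ss : List A) i → belowGap ss i ≡ belowGap (drop i ss) 0
belowGap-drop [] zero = refl
belowGap-drop [] (suc i) = refl
belowGap-drop (x ∷ xs) zero = refl
belowGap-drop (x ∷ xs) (suc i) = belowGap-drop xs i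

∈-take⊎drop : ∀ {A : Set} {x : A} ss i → x ∈ ss → x ∈ take i ss ⊎ x ∈ drop i ss
∈-take⊎drop ss zero m = inj₂ m
∈-take⊎drop (y ∷ ys) (suc i) (here e) = inj₁ (here e)
∈-take⊎drop (y ∷ ys) (suc i) (there m) with ∈-take⊎drop ys i m
... | inj₁ m′ = inj₁ (there m′)
... | inj₂ m′ = inj₂ m′

module Chains {n} {δ : Vec DecoID n} (p : ParentMap δ) (Pp : IsPermutree δ p) where
  open IsPermutree Pp

  chain-parent : ∀ {z ys y} → LeftChain δ p (just z) ys → y ∈ ys →
      Σ (ParentPos δ) λ pp → p y ≡ just pp × InSubtree δ p z (proj₁ pp)
  chain-parent (cons e c) (here refl) = _ , e , here
  chain-parent (cons e c) (there m) with chain-parent c m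
  ... | pp , e′ , r = pp , e′ , inSubtree-parent r e

  chain-below : ∀ {z ys y} → LeftChain δ p (just z) ys → y ∈ ys → InSubtree δ p z y
  chain-below c m with chain-parent c m
  ... | pp , e , r = there e r

  chain-below-≢ : ∀ {z ys y} → LeftChain δ p (just z) ys → y ∈ ys → z ≢ y
  chain-below-≢ c m refl with chain-parent c m
  ... | (k , s) , e , r = acyclic _ k s e r

  chain-drop : ∀ {prev ss} i → LeftChain δ p prev ss → LeftChain δ p (aboveGap prev ss i) (drop i ss)
  chain-drop zero c = c
  chain-drop (suc i) (nil x) = nil x
  chain-drop (suc i) (cons e c) = chain-drop i c

  same-parent : ∀ {x y m} → p x ≡ m → p y ≡ m → x ≡ y
  same-parent {m = nothing} e1 e2 = trans (proj₂ (proj₂ uniqueRoot) _ e1)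
      (sym (proj₂ (proj₂ uniqueRoot) _ e2))
  same-parent {m = just pp} e1 e2 = slotInjective _ _ pp e1 e2

  chain-head-occupies : ∀ {prev ss} → LeftChain δ p prev ss → Occupies δ p prev (belowGap ss 0)
  chain-head-occupies (nil nx) x = (λ ()) , λ e → ⊥-elim (nx x e)
  chain-head-occupies (cons e c) x = (λ { refl → e }) , λ e′ → cong just (same-parent e e′)

  chain-link : ∀ {prev ss x} → LeftChain δ p prev ss → x ∈ ss →
      p x ≡ leftChildOf δ prev ⊎ Σ (Fin n) (λ x′ → x′ ∈ ss × p x ≡ leftChildOf δ (just x′))
  chain-link (cons e c) (here refl) = inj₁ e
  chain-link (cons {x = x} e c) (there m) with chain-link c m
  ... | inj₁ e′ = inj₂ (x , here refl , e′)
  ... | inj₂ (x′ , m′ , e′) = inj₂ (x′ , there m′ , e′)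

  chain-notInRight : ∀ {ss} → LeftChain δ p nothing ss → ∀ {x} → x ∈ ss → NotInRightSubtree δ p x
  chain-notInRight c m y z s e isR here with chain-link c m
  ... | inj₁ e′ with trans (sym e′) e
  ... | ()
  chain-notInRight c m y z s e isR here | inj₂ (x′ , m′ , e′) with trans (sym e′) e
  ... | refl = ¬IsRight-leftSlot (lookup δ z) isR
  chain-notInRight c m y z s e isR (there e1 r) with chain-link c m
  ... | inj₁ e′ with trans (sym e′) e1
  ... | ()
  chain-notInRight c m y z s e isR (there e1 r) | inj₂ (x′ , m′ , e′) with trans (sym e′) e1
  ... | refl = chain-notInRight c m′ y z s e isR r

  aboveGap-ancestor : ∀ {x xs} j {y} → LeftChain δ p (just x) xs → aboveGap (just x) xs j ≡ just y →
      InSubtree δ p x y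
  aboveGap-ancestor zero c refl = here
  aboveGap-ancestor {xs = []} (suc j) c refl = here
  aboveGap-ancestor {xs = w ∷ ws} (suc j) (cons e c) eq = inSubtree-parent (aboveGap-ancestor j c eq) e

  aboveGap-injective : ∀ {prev ss} → LeftChain δ p prev ss → ∀ i i′ → i ≤ length ss → i′ ≤ length ss →
      aboveGap prev ss i ≡ aboveGap prev ss i′ → i ≡ i′
  aboveGap-injective c zero zero _ _ _ = refl
  aboveGap-injective {prev} {x ∷ xs} (cons e c) zero (suc j) _ _ eq with aboveGap-just x xs j
  ... | y , ey with trans eq ey
  ... | refl = ⊥-elim (acyclic x y _ e (aboveGap-ancestor j c ey))
  aboveGap-injective {prev} {x ∷ xs} (cons e c) (suc j) zero _ _ eq with aboveGap-just x xs j
  ... | y , ey with trans (sym eq) ey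
  ... | refl = ⊥-elim (acyclic x y _ e (aboveGap-ancestor j c ey))
  aboveGap-injective {prev} {x ∷ xs} (cons e c) (suc j) (suc j′) (s≤s b) (s≤s b′) eq = cong suc
      (aboveGap-injective c j j′ b b′ eq)

  belowGap-∉-take : ∀ {prev ss} i → LeftChain δ p prev ss → All (λ w → belowGap ss i ≢ just w) (take i ss)
  belowGap-∉-take zero c = []
  belowGap-∉-take (suc i) (nil _) = []
  belowGap-∉-take {ss = x ∷ xs} (suc i) (cons e c) = (λ eq → chain-below-≢ c (belowGap-∈ xs i eq) refl) ∷
      belowGap-∉-take i c

  ∈⇒aboveGap : ∀ {prev ss u} → LeftChain δ p prev ss → u ∈ ss →
      Σ ℕ λ i → suc i ≤ length ss × aboveGap prev ss (suc i) ≡ just u × LeftChain δ p (just u) (drop (suc i) ss)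
  ∈⇒aboveGap (cons e c) (here refl) = 0 , s≤s z≤n , refl , c
  ∈⇒aboveGap (cons e c) (there m) with ∈⇒aboveGap c m
  ... | i , b , eq , c′ = suc i , s≤s b , eq , c′

module InsertAtGap {n} (d : DecoID) (δ′ : Vec DecoID n) (p : ParentMap δ′) (ss : List (Fin n))
    (Iv : Spine δ′ p ss) (i : ℕ) where
  open Insert d δ′
  open Spine Iv
  open Chains p isPermutree
  up = aboveGap nothing ss i
  dn = belowGap ss i

  occ : Occupies δ′ p up dn
  occ = subst (Occupies δ′ p up) (sym (belowGap-drop ss i)) (chain-head-occupies (chain-drop i leftChain))

  leftOf-notInRight : ∀ u → up ≡ just u → NotInRightSubtree δ′ p u
  leftOf-notInRight u e = chain-notInRight leftChain (aboveGap-root-∈ ss i e)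

  open Inserted p up dn
  open Occupied occ
  open Forward isPermutree leftOf-notInRight

  shiftPos-leftChildOf : ∀ m → shiftPos (leftChildOf δ′ m) ≡ leftChildOf δ (Maybe.map suc m)
  shiftPos-leftChildOf nothing = refl
  shiftPos-leftChildOf (just u) = refl

  shift-chain : ∀ {y ys} → LeftChain δ′ p (just y) ys → All (λ w → dn ≢ just w) ys →
      (Σ (Fin n) λ w → p w ≡ leftChildOf δ′ up) → LeftChain δ q (just (suc y)) (List.map suc ys)
  shift-chain {y} {[]} (nil nx) [] (w , ew) = nil f
    where
    f : ∀ X → q X ≢ leftChildOf δ (just (suc y))
    f zero e = nx w (trans ew (shiftPos-injective e))
    f (suc k) e with occupant? k
    ... | inj₁ y′ with trans (sym (insert-occupant k y′)) e
    ... | ()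
    f (suc k) e | inj₂ ne = nx k (shiftPos-suc⁻¹ (trans (sym (insert-other k ne)) e))
  shift-chain {y} {w ∷ ws} (cons e c) (ne ∷ a) h = cons (trans (insert-other w ne) (cong shiftPos e))
      (shift-chain c a h)

  inserted-chain : ∀ {prev ss₀} j → LeftChain δ′ p prev ss₀ →
      aboveGap prev ss₀ j ≡ up → belowGap ss₀ j ≡ dn → All (λ w → dn ≢ just w) (take j ss₀) →
      LeftChain δ q (just zero) (spineTail d (drop j ss₀)) →
      LeftChain δ q (Maybe.map suc prev) (List.map suc (take j ss₀) ++ zero ∷ spineTail d (drop j ss₀))
  inserted-chain {prev} zero c eu ed a tc = cons
      (trans (cong (λ m → shiftPos (leftChildOf δ′ m)) (sym eu)) (shiftPos-leftChildOf prev)) tc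
  inserted-chain {prev} {[]} (suc j) c eu ed a tc = cons
      (trans (cong (λ m → shiftPos (leftChildOf δ′ m)) (sym eu)) (shiftPos-leftChildOf prev)) tc
  inserted-chain {prev} {x ∷ xs} (suc j) (cons e c) eu ed (ne ∷ a) tc =
    cons (trans (insert-other x ne) (trans (cong shiftPos e) (shiftPos-leftChildOf prev)))
        (inserted-chain j c eu ed a tc)

  notInRight-lower : ∀ j → NotInRightSubtree δ q (suc j) → NotInRightSubtree δ′ p j
  notInRight-lower j nr y z s e isR r with occupant? y
  ... | inj₂ ny = nr (suc y) (suc z) s (trans (insert-other y ny) (cong shiftPos e)) isR
      (lift-InSubtree r)
  ... | inj₁ y′ with leftChildOf-just (trans (sym (proj₁ (occ y) y′)) e)
  ... | eu with trans (sym (cong (leftChildOf δ′) eu)) (trans (sym (proj₁ (occ y) y′)) e)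
  ... | refl = ¬IsRight-leftSlot (lookup δ′ z) isR

  inserted-spine-complete :
      (∀ j → j ∈ drop i ss → NotInRightSubtree δ q (suc j) → suc j ∈ spineTail d (drop i ss)) →
      ∀ J → NotInRightSubtree δ q J → J ∈ insertSpine d ss i
  inserted-spine-complete h zero nr = ∈-++⁺ʳ (List.map suc (take i ss)) (here refl)
  inserted-spine-complete h (suc j) nr with ∈-take⊎drop ss i (complete j (notInRight-lower j nr))
  ... | inj₁ m = ∈-++⁺ˡ (∈-map⁺ suc m)
  ... | inj₂ m = ∈-++⁺ʳ (List.map suc (take i ss)) (there (h j m nr))

  drop-below-occupant : ∀ {j} → j ∈ drop i ss → Σ (Fin n) λ x → dn ≡ just x × InSubtree δ′ p x j
  drop-below-occupant m with drop i ss | chain-drop i leftChain | belowGap-drop ss i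
  drop-below-occupant (here refl) | x ∷ xs | cons e c | ed = x , ed , here
  drop-below-occupant (there m) | x ∷ xs | cons e c | ed = x , ed , chain-below c m

module SpineInsertion {n} (δ′ : Vec DecoID n) (p : ParentMap δ′) (ss : List (Fin n)) (Iv : Spine δ′ p ss)
    (i : ℕ) where
  open Spine Iv
  up = aboveGap nothing ss i
  dn = belowGap ss i

  insertedMap : (d : DecoID) → ParentMap (d ∷ δ′)
  insertedMap d = Insert.insert d δ′ p up dn

  spineTail-chain : ∀ d → LeftChain (d ∷ δ′) (insertedMap d) (just zero) (spineTail d (drop i ss))
  spineTail-chain D = nil f
    where
    open InsertAtGap D δ′ p ss Iv i hiding (up; dn)
    open Insert D δ′
    open Inserted p up dn
    f : ∀ X → insertedMap D X ≢ just (zero , left)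
    f zero e = shiftPos≢zero e
    f (suc k) e with occupant? k
    ... | inj₁ y with trans (sym (insert-occupant k y)) e
    ... | ()
    f (suc k) e | inj₂ ne = shiftPos≢zero (trans (sym (insert-other k ne)) e)
  spineTail-chain I = shifted-tail (drop i ss) (chain-drop i leftChain) (belowGap-drop ss i)
    where
    open InsertAtGap I δ′ p ss Iv i hiding (up; dn)
    open Insert I δ′
    open Inserted p up dn
    open Chains p isPermutree
    shifted-tail : ∀ xs → LeftChain δ′ p up xs → dn ≡ belowGap xs 0 →
        LeftChain (I ∷ δ′) (insertedMap I) (just zero) (List.map suc xs)
    shifted-tail [] c ed = nil f
      where
      f : ∀ X → insertedMap I X ≢ just (zero , tt)
      f zero e = shiftPos≢zero e
      f (suc k) e with occupant? k
      ... | inj₁ y with trans (sym ed) y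
      ... | ()
      f (suc k) e | inj₂ ne = shiftPos≢zero (trans (sym (insert-other k ne)) e)
    shifted-tail (y ∷ ys) (cons e c) ed = cons (insert-occupant y ed)
        (shift-chain c (All.tabulate λ m eq → chain-below-≢ c m (just-injective (trans (sym ed) eq)))
        (y , e))

  drop-notInRight : ∀ d j → j ∈ drop i ss → NotInRightSubtree (d ∷ δ′) (insertedMap d) (suc j) →
      suc j ∈ spineTail d (drop i ss)
  drop-notInRight I j m nr = ∈-map⁺ suc m
  drop-notInRight D j m nr with InsertAtGap.drop-below-occupant D δ′ p ss Iv i m
  ... | x , ex , r = ⊥-elim (nr (suc x) zero right (Insert.Inserted.insert-occupant D δ′ p up dn x ex) tt
                               (Insert.Inserted.Occupied.lift-InSubtree D δ′ p up dn
                                   (InsertAtGap.occ D δ′ p ss Iv i) r))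

  insert-spine : ∀ d → Spine (d ∷ δ′) (insertedMap d) (insertSpine d ss i)
  insert-spine d = record
    { isPermutree = insert-isPermutree
    ; leftChain = inserted-chain i leftChain refl refl (belowGap-∉-take i leftChain) (spineTail-chain d)
    ; complete = inserted-spine-complete (drop-notInRight d) }
    where
    open InsertAtGap d δ′ p ss Iv i hiding (up; dn)
    open Chains p isPermutree
    open Insert.Inserted.Occupied.Forward d δ′ p up dn occ isPermutree leftOf-notInRight

-- A code lists, for v₁, …, vₙ₋₁, the spine gap at which the node is inserted into the tree on
-- the later nodes; spineLength is the length of the resulting spine.
spineLength : ∀ {m} → Vec DecoID (suc m) → Vec ℕ m → ℕ
spineLength {zero} (d ∷ []) [] = 1
spineLength {suc m} (I ∷ δ′) (i ∷ cs) = suc (spineLength δ′ cs)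
spineLength {suc m} (D ∷ δ′) (i ∷ cs) = suc i

ValidCode : ∀ {m} → Vec DecoID (suc m) → Vec ℕ m → Set
ValidCode {zero} _ [] = ⊤
ValidCode {suc m} (d ∷ δ′) (i ∷ cs) = i ≤ spineLength δ′ cs × ValidCode δ′ cs

decodeTree : ∀ {m} (δ : Vec DecoID (suc m)) → Vec ℕ m → ParentMap δ × List (Fin (suc m))
decodeTree {zero} (d ∷ []) [] = (λ _ → nothing) , zero ∷ []
decodeTree {suc m} (d ∷ δ′) (i ∷ cs) =
  Insert.insert d δ′ p (aboveGap nothing ss i) (belowGap ss i) , insertSpine d ss i
  where
  p = proj₁ (decodeTree δ′ cs)
  ss = proj₂ (decodeTree δ′ cs)

insertSpine-length-I : ∀ {n} (ss : List (Fin n)) i → i ≤ length ss →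
    length (insertSpine I ss i) ≡ suc (length ss)
insertSpine-length-I ss zero b = cong suc (Listₚ.length-map suc ss)
insertSpine-length-I (x ∷ xs) (suc i) (s≤s b) = cong suc (insertSpine-length-I xs i b)

insertSpine-length-D : ∀ {n} (ss : List (Fin n)) i → i ≤ length ss → length (insertSpine D ss i) ≡ suc i
insertSpine-length-D ss zero b = refl
insertSpine-length-D (x ∷ xs) (suc i) (s≤s b) = cong suc (insertSpine-length-D xs i b)

insertSpine-length : ∀ {m} d (δ′ : Vec DecoID (suc m)) cs (ss : List (Fin (suc m))) i → i ≤ length ss →
    length ss ≡ spineLength δ′ cs → length (insertSpine d ss i) ≡ spineLength (d ∷ δ′) (i ∷ cs)
insertSpine-length I δ′ cs ss i b e = trans (insertSpine-length-I ss i b) (cong suc e)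
insertSpine-length D δ′ cs ss i b e = insertSpine-length-D ss i b

singleton-isPermutree : (d : DecoID) → IsPermutree (d ∷ []) (λ _ → nothing)
singleton-isPermutree d = record
  { slotInjective = λ { _ _ _ () _ }
  ; acyclic = λ { _ _ _ () }
  ; uniqueRoot = zero , refl , λ { zero _ → refl }
  ; leftSmaller = λ { _ _ _ () }
  ; rightBigger = λ { _ _ _ () } }

decodeTree-spine : ∀ {m} δ cs → ValidCode {m} δ cs →
    Spine δ (proj₁ (decodeTree δ cs)) (proj₂ (decodeTree δ cs)) × length (proj₂ (decodeTree δ cs)) ≡ spineLength δ cs
decodeTree-spine {zero} (d ∷ []) [] v = record
  { isPermutree = singleton-isPermutree d
  ; leftChain = cons refl (nil λ x ())
  ; complete = λ { zero _ → here refl } } , refl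
decodeTree-spine {suc m} (d ∷ δ′) (i ∷ cs) (b , v) =
  SpineInsertion.insert-spine δ′ (proj₁ r) (proj₂ r) (proj₁ ih) i d ,
  insertSpine-length d δ′ cs (proj₂ r) i (subst (i ≤_) (sym (proj₂ ih)) b) (proj₂ ih)
  where
  r = decodeTree δ′ cs
  ih = decodeTree-spine δ′ cs v

decodeTree-injective : ∀ {m} δ cs cs₂ → ValidCode {m} δ cs → ValidCode δ cs₂ →
    (∀ K → proj₁ (decodeTree δ cs) K ≡ proj₁ (decodeTree δ cs₂) K) → cs ≡ cs₂
decodeTree-injective {zero} (d ∷ []) [] [] _ _ _ = refl
decodeTree-injective {suc m} (d ∷ δ′) (i ∷ cs) (i₂ ∷ cs₂) (i≤ , v) (i₂≤ , v₂) eq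
  with decodeTree-injective δ′ cs cs₂ v v₂ smaller-trees-agree
  where
  r = decodeTree δ′ cs
  r₂ = decodeTree δ′ cs₂
  occ = InsertAtGap.occ d δ′ (proj₁ r) (proj₂ r) (proj₁ (decodeTree-spine δ′ cs v)) i
  occ₂ = InsertAtGap.occ d δ′ (proj₁ r₂) (proj₂ r₂) (proj₁ (decodeTree-spine δ′ cs₂ v₂)) i₂
  smaller-trees-agree : ∀ k → proj₁ r k ≡ proj₁ r₂ k
  smaller-trees-agree k = begin
    proj₁ r k                                                     ≡⟨ Insert.remove-insert d δ′ _ _ _ occ k ⟨
    Insert.remove d δ′ (proj₁ (decodeTree (d ∷ δ′) (i ∷ cs))) k
      ≡⟨ cong₂ (Insert.removePos d δ′) (eq (suc k)) (eq zero) ⟩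
    Insert.remove d δ′ (proj₁ (decodeTree (d ∷ δ′) (i₂ ∷ cs₂))) k ≡⟨ Insert.remove-insert d δ′ _ _ _ occ₂ k ⟩
    proj₁ r₂ k                                                    ∎
    where open ≡-Reasoning
... | refl = cong (_∷ cs) same-gap
  where
  r = decodeTree δ′ cs
  sp = decodeTree-spine δ′ cs v
  same-gap : i ≡ i₂
  same-gap = Chains.aboveGap-injective (proj₁ r) (Spine.isPermutree (proj₁ sp)) (Spine.leftChain (proj₁ sp)) i i₂
    (subst (i ≤_) (sym (proj₂ sp)) i≤) (subst (i₂ ≤_) (sym (proj₂ sp)) i₂≤)
    (leftChildOf-injective (Insert.shiftPos-injective d δ′ (eq zero)))

module FindGap {n} (δ′ : Vec DecoID n) (P : ParentMap δ′) (ss : List (Fin n)) (Iv : Spine δ′ P ss)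
               (up dn : Maybe (Fin n)) (occ : Occupies δ′ P up dn)
                   (leftOf-notInRight : ∀ u → up ≡ just u → NotInRightSubtree δ′ P u) where
  open Spine Iv
  open IsPermutree isPermutree using (uniqueRoot)

  occupant-follows : ∀ {u} xs → LeftChain δ′ P (just u) xs → up ≡ just u → belowGap xs 0 ≡ dn
  occupant-follows [] (nil nx) eu with nothing⊎just dn
  ... | inj₁ e = sym e
  ... | inj₂ (x , e) = ⊥-elim (nx x (trans (proj₁ (occ x) e) (cong (leftChildOf δ′) eu)))
  occupant-follows (y ∷ ys) (cons e c) eu = sym (proj₂ (occ y) (trans e (cong (leftChildOf δ′) (sym eu))))

  findGap : Σ ℕ λ i → i ≤ length ss × aboveGap nothing ss i ≡ up × belowGap ss i ≡ dn
  findGap with nothing⊎just up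
  findGap | inj₁ eu = 0 , z≤n , sym eu , occupant-heads ss leftChain
    where
    occupant-heads : ∀ xs → LeftChain δ′ P nothing xs → belowGap xs 0 ≡ dn
    occupant-heads [] (nil nx) = ⊥-elim (nx (proj₁ uniqueRoot) (proj₁ (proj₂ uniqueRoot)))
    occupant-heads (y ∷ ys) (cons e c) = sym (proj₂ (occ y) (trans e (cong (leftChildOf δ′) (sym eu))))
  findGap | inj₂ (u , eu) with Chains.∈⇒aboveGap P isPermutree leftChain
      (complete u (leftOf-notInRight u eu))
  ... | i , b , equ , c′ = suc i , b , trans equ (sym eu) , trans (belowGap-drop ss (suc i)) (occupant-follows _ c′ eu)

decodeTree-surjective : ∀ {m} δ (p : ParentMap δ) → IsPermutree δ p →
    Σ (Vec ℕ m) λ cs → ValidCode δ cs × (∀ K → proj₁ (decodeTree δ cs) K ≡ p K)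
decodeTree-surjective {zero} (d ∷ []) p Pp = [] , tt , root
  where
  root : ∀ K → nothing ≡ p K
  root zero with p zero in e
  ... | nothing = refl
  ... | just (zero , s) = ⊥-elim (IsPermutree.acyclic Pp zero zero s e here)
decodeTree-surjective {suc m} (d ∷ δ′) p Pp = (i ∷ cs) , (subst (i ≤_) (proj₂ sp) i≤ , v) , decode≗p
  where
  open Insert d δ′
  open Decompose p Pp
  inserted-isPermutree : IsPermutree (d ∷ δ′) (insert p′ up dn)
  inserted-isPermutree = isPermutree-resp (λ K → sym (insert-remove K)) Pp
  ih = decodeTree-surjective δ′ p′
         (Inserted.Occupied.Backward.insert-isPermutree⁻¹ p′ up dn remove-occupies inserted-isPermutree zero)
  cs = proj₁ ih
  v = proj₁ (proj₂ ih)
  decode≗p′ = proj₂ (proj₂ ih)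
  P = proj₁ (decodeTree δ′ cs)
  ss = proj₂ (decodeTree δ′ cs)
  sp = decodeTree-spine δ′ cs v
  up-notInRight : ∀ u → up ≡ just u → NotInRightSubtree δ′ P u
  up-notInRight u eu = notInRight-resp (λ k → sym (decode≗p′ k))
      (Inserted.Occupied.leftChildOf-notInRight p′ up dn remove-occupies inserted-isPermutree u eu)
  gap = FindGap.findGap δ′ P ss (proj₁ sp) up dn
          (occupies-resp (λ k → sym (decode≗p′ k)) remove-occupies) up-notInRight
  i = proj₁ gap
  i≤ = proj₁ (proj₂ gap)
  decode≗p : ∀ K → insert P (aboveGap nothing ss i) (belowGap ss i) K ≡ p K
  decode≗p K rewrite proj₁ (proj₂ (proj₂ gap)) | proj₂ (proj₂ (proj₂ gap)) =
    trans (insert-resp up dn decode≗p′ K) (insert-remove K)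

CodeSetoid : ∀ {m} → Vec DecoID (suc m) → Setoid _ _
CodeSetoid {m} δ = record
  { Carrier = Σ (Vec ℕ m) (ValidCode δ)
  ; _≈_ = λ a b → proj₁ a ≡ proj₁ b
  ; isEquivalence = record { refl = refl ; sym = sym ; trans = trans } }

codes⤖permutrees : ∀ {m} (δ : Vec DecoID (suc m)) → Bijection (CodeSetoid δ) (PermutreeSetoid δ)
codes⤖permutrees δ = record
  { to = toPermutree
  ; cong = λ { refl k → refl }
  ; bijective = (λ {x} {y} → decodeTree-injective δ (proj₁ x) (proj₁ y) (proj₂ x) (proj₂ y)) , surjective }
  where
  toPermutree : Σ _ (ValidCode δ) → Permutree δ
  toPermutree (cs , v) = record
    { parent = proj₁ (decodeTree δ cs) ; isPermutree = Spine.isPermutree (proj₁ (decodeTree-spine δ cs v)) }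
  surjective : ∀ t → Σ (Σ _ (ValidCode δ)) λ c → ∀ {c′} → proj₁ c′ ≡ proj₁ c →
               ∀ k → Permutree.parent (toPermutree c′) k ≡ Permutree.parent t k
  surjective t with decodeTree-surjective δ (Permutree.parent t) (Permutree.isPermutree t)
  ... | cs , v , eq = (cs , v) , λ { refl k → eq k }

contrib : ℕ → ℕ → ℕ → ℕ
contrib t v x = if ⌊ t ℕ.≟ v ⌋ then x else 0

contrib-≡ : ∀ v x → contrib v v x ≡ x
contrib-≡ v x with v ℕ.≟ v
... | yes _ = refl
... | no v≢v = ⊥-elim (v≢v refl)

contrib-≢ : ∀ t v x → t ≢ v → contrib t v x ≡ 0
contrib-≢ t v x t≢v with t ℕ.≟ v
... | yes t≡v = ⊥-elim (t≢v t≡v)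
... | no _ = refl

contrib-0 : ∀ t v → contrib t v 0 ≡ 0
contrib-0 t v with t ℕ.≟ v
... | yes _ = refl
... | no _ = refl

endpointSum : (ℕ × ℕ → ℕ) → (E : Edges) → (Fin (length E) → ℕ) → ℕ → ℕ
endpointSum end [] f v = 0
endpointSum end (e ∷ E) f v = contrib (end e) v (f zero) + endpointSum end E (f ∘ suc) v

outflow′ inflow′ : (E : Edges) → (Fin (length E) → ℕ) → ℕ → ℕ
outflow′ = endpointSum proj₁
inflow′ = endpointSum proj₂

endpointSum-correct : ∀ end E f v →
  sum (List.map (λ e → contrib (end (List.lookup E e)) v (f e)) (List.allFin (length E))) ≡ endpointSum
      end E f v
endpointSum-correct end [] f v = refl
endpointSum-correct end (x ∷ E) f v = cong (contrib (end x) v (f zero) +_) (begin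
  sum (List.map g (List.tabulate suc))     ≡⟨ cong sum (Listₚ.map-tabulate suc g) ⟩
  sum (List.tabulate (g ∘ suc))            ≡⟨ cong sum (Listₚ.map-tabulate id (g ∘ suc)) ⟨
  sum (List.map (g ∘ suc) (List.allFin _)) ≡⟨ endpointSum-correct end E (f ∘ suc) v ⟩
  endpointSum end E (f ∘ suc) v            ∎)
  where
  open ≡-Reasoning
  g = λ e → contrib (end (List.lookup (x ∷ E) e)) v (f e)

outflow≡outflow′ : ∀ E f v → outflow E f v ≡ outflow′ E f v
outflow≡outflow′ = endpointSum-correct proj₁

inflow≡inflow′ : ∀ E f v → inflow E f v ≡ inflow′ E f v
inflow≡inflow′ = endpointSum-correct proj₂

-- Bic_δ level by level from the top: a vector of length j + 1 starts with the edges leaving vⱼ.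
bichoBlock : ℕ → ℕ → DecoID → Edges
bichoBlock n a I = (a , suc a) ∷ (a , suc a) ∷ []
bichoBlock n a D = (a , suc a) ∷ (0 , suc a) ∷ (a , n) ∷ []

bicho : ℕ → ∀ {j} → Vec DecoID j → Edges
bicho n [] = []
bicho n {suc j} (d ∷ δ) = bichoBlock n j d ++ bicho n δ

edgesAtLevel : ℕ → Deco → ℕ → Edges
edgesAtLevel n d t = edgeOrMoved n (moveBump d) (n ∸ suc t) ++ edgeOrMoved n (moveDip d) (n ∸ suc t)

edgeOrMoved-toDeco : ∀ n d a →
    edgeOrMoved n (moveBump (toDeco d)) a ++ edgeOrMoved n (moveDip (toDeco d)) a ≡ bichoBlock n a d
edgeOrMoved-toDeco n I a = refl
edgeOrMoved-toDeco n D a = refl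

[o+1+j]∸[1+o+0]≡j : ∀ o j → (o + suc j) ∸ suc (o + 0) ≡ j
[o+1+j]∸[1+o+0]≡j o j = trans (cong₂ _∸_ (ℕₚ.+-suc o j) (cong suc (ℕₚ.+-identityʳ o))) (ℕₚ.m+n∸m≡n o j)

edgesFrom≡bicho : ∀ n o {j} (δs : Vec DecoID j) → o + j ≡ n →
    List.concat (List.tabulate {n = j} (λ k → edgesAtLevel n (toDeco (lookup δs k)) (o + toℕ k))) ≡ bicho n δs
edgesFrom≡bicho n o [] e = refl
edgesFrom≡bicho n o {suc j} (d ∷ δs) e = cong₂ _++_ hd tl
  where
  hd : edgesAtLevel n (toDeco d) (o + 0) ≡ bichoBlock n j d
  hd = trans (cong (λ a → edgeOrMoved n (moveBump (toDeco d)) a ++ edgeOrMoved n (moveDip (toDeco d)) a)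
                   (trans (cong (λ m → m ∸ suc (o + 0)) (sym e)) ([o+1+j]∸[1+o+0]≡j o j))) (edgeOrMoved-toDeco n d j)
  tl = trans (cong List.concat (Listₚ.tabulate-cong
             (λ k → cong (edgesAtLevel n (toDeco (lookup δs k))) (ℕₚ.+-suc o (toℕ k)))))
           (edgesFrom≡bicho n (suc o) δs (trans (sym (ℕₚ.+-suc o j)) e))

Bic≡bicho : ∀ {n} (δ : Vec DecoID n) → Bic (map toDeco δ) ≡ bicho n δ
Bic≡bicho {n} δ = trans
  (cong List.concat (trans (Listₚ.map-tabulate id levels)
    (Listₚ.tabulate-cong (λ k → cong (λ d → edgesAtLevel n d (toℕ k)) (Vecₚ.lookup-map k toDeco δ)))))
  (edgesFrom≡bicho n 0 δ refl)
  where levels = λ k → edgesAt n (lookup (map toDeco δ) k) k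

-- Conserved v out in: conservation at vᵥ for the demand 0 at v₀ and 1 at the inner vertices.
Conserved : ℕ → ℕ → ℕ → Set
Conserved zero o i = o ≡ i
Conserved (suc v) o i = o ≡ suc i

+-pres-≡0 : ∀ {a b} → a ≡ 0 → b ≡ 0 → a + b ≡ 0
+-pres-≡0 refl refl = refl

module PartialFlows (n : ℕ) (n≢0 : n ≢ 0) where

  FlowOn : ∀ {j} → Vec DecoID j → Set
  FlowOn δs = Fin (length (bicho n δs)) → ℕ

  out : ∀ {j} (δs : Vec DecoID j) → FlowOn δs → ℕ → ℕ
  out δs = outflow′ (bicho n δs)

  inn : ∀ {j} (δs : Vec DecoID j) → FlowOn δs → ℕ → ℕ
  inn δs = inflow′ (bicho n δs)

  IsPartialFlow : ∀ {j} (δs : Vec DecoID j) → FlowOn δs → Set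
  IsPartialFlow {j} δs f = ∀ v → v < j → Conserved v (out δs f v) (inn δs f v)

  inflow-source : ∀ {j} (δs : Vec DecoID j) f → inn δs f 0 ≡ 0
  inflow-source [] f = refl
  inflow-source {suc j} (I ∷ δs) f = +-pres-≡0 (contrib-≢ (suc j) 0 (f zero) ℕₚ.1+n≢0)
      (+-pres-≡0 (contrib-≢ (suc j) 0 (f (suc zero)) ℕₚ.1+n≢0) (inflow-source δs _))
  inflow-source {suc j} (D ∷ δs) f = +-pres-≡0 (contrib-≢ (suc j) 0 (f zero) ℕₚ.1+n≢0)
      (+-pres-≡0 (contrib-≢ (suc j) 0 (f (suc zero)) ℕₚ.1+n≢0)
      (+-pres-≡0 (contrib-≢ n 0 (f (suc (suc zero))) n≢0) (inflow-source δs _)))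

  outflow-above : ∀ {j} (δs : Vec DecoID j) f v → j ≤ v → v ≢ 0 → out δs f v ≡ 0
  outflow-above [] f v b nz = refl
  outflow-above {suc j} (I ∷ δs) f v b nz = +-pres-≡0 (contrib-≢ j v (f zero) (ℕₚ.<⇒≢ b))
      (+-pres-≡0 (contrib-≢ j v (f (suc zero)) (ℕₚ.<⇒≢ b)) (outflow-above δs _ v (ℕₚ.<⇒≤ b) nz))
  outflow-above {suc j} (D ∷ δs) f v b nz = +-pres-≡0 (contrib-≢ j v (f zero) (ℕₚ.<⇒≢ b))
      (+-pres-≡0 (contrib-≢ 0 v (f (suc zero)) (λ e → nz (sym e)))
      (+-pres-≡0 (contrib-≢ j v (f (suc (suc zero))) (ℕₚ.<⇒≢ b)) (outflow-above δs _ v (ℕₚ.<⇒≤ b) nz)))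

  inflow-above : ∀ {j} (δs : Vec DecoID j) f v → j < v → v ≢ n → inn δs f v ≡ 0
  inflow-above [] f v b nn = refl
  inflow-above {suc j} (I ∷ δs) f v b nn = +-pres-≡0 (contrib-≢ (suc j) v (f zero) (ℕₚ.<⇒≢ b))
      (+-pres-≡0 (contrib-≢ (suc j) v (f (suc zero)) (ℕₚ.<⇒≢ b))
      (inflow-above δs _ v (ℕₚ.<-trans (ℕₚ.n<1+n j) b) nn))
  inflow-above {suc j} (D ∷ δs) f v b nn = +-pres-≡0 (contrib-≢ (suc j) v (f zero) (ℕₚ.<⇒≢ b))
      (+-pres-≡0 (contrib-≢ (suc j) v (f (suc zero)) (ℕₚ.<⇒≢ b))
      (+-pres-≡0 (contrib-≢ n v (f (suc (suc zero))) (λ e → nn (sym e)))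
      (inflow-above δs _ v (ℕₚ.<-trans (ℕₚ.n<1+n j) b) nn)))

  drop-two-zeros : ∀ {a b x} → a ≡ 0 → b ≡ 0 → a + (b + x) ≡ x
  drop-two-zeros refl refl = refl

  drop-three-zeros : ∀ {a b c x} → a ≡ 0 → b ≡ 0 → c ≡ 0 → a + (b + (c + x)) ≡ x
  drop-three-zeros refl refl refl = refl

  +≡0⇒≡0×≡0 : ∀ {a b} → a + b ≡ 0 → a ≡ 0 × b ≡ 0
  +≡0⇒≡0×≡0 {a} e = ℕₚ.m+n≡0⇒m≡0 a e , ℕₚ.m+n≡0⇒n≡0 a e

  module SplitI {j′} (δt : Vec DecoID (suc j′)) (f : FlowOn (I ∷ δt)) where
    J = suc j′
    ft : FlowOn δt
    ft e = f (suc (suc e))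
    f0 = f zero
    f1 = f (suc zero)

    outLow : ∀ v → v ≢ J → out (I ∷ δt) f v ≡ out δt ft v
    outLow v ne = drop-two-zeros (contrib-≢ J v f0 (λ e → ne (sym e)))
        (contrib-≢ J v f1 (λ e → ne (sym e)))
    inLow : ∀ v → v ≢ suc J → inn (I ∷ δt) f v ≡ inn δt ft v
    inLow v ne = drop-two-zeros (contrib-≢ (suc J) v f0 (λ e → ne (sym e)))
        (contrib-≢ (suc J) v f1 (λ e → ne (sym e)))
    outJ : out (I ∷ δt) f J ≡ f0 + f1
    outJ = trans (cong₂ _+_ (contrib-≡ J f0)
        (cong₂ _+_ (contrib-≡ J f1) (outflow-above δt ft J ℕₚ.≤-refl ℕₚ.1+n≢0)))
        (cong (f0 +_) (ℕₚ.+-identityʳ f1))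

    inNext : suc J < n → inn (I ∷ δt) f (suc J) ≡ f0 + f1
    inNext b = trans (cong₂ _+_ (contrib-≡ (suc J) f0)
        (cong₂ _+_ (contrib-≡ (suc J) f1) (inflow-above δt ft (suc J) (ℕₚ.n<1+n J) (ℕₚ.<⇒≢ b))))
        (cong (f0 +_) (ℕₚ.+-identityʳ f1))

    split⇒ : IsPartialFlow (I ∷ δt) f → (f0 + f1 ≡ suc (inn δt ft J)) × IsPartialFlow δt ft
    split⇒ P = subst₂ (λ o i → o ≡ suc i) outJ (inLow J ((ℕₚ.<⇒≢ (ℕₚ.n<1+n J)))) (P J (ℕₚ.n<1+n J)) ,
               λ v v<J → subst₂ (Conserved v) (outLow v (ℕₚ.<⇒≢ v<J))
                   (inLow v (ℕₚ.<⇒≢ (ℕₚ.<-trans v<J (ℕₚ.n<1+n J)))) (P v (ℕₚ.<-trans v<J (ℕₚ.n<1+n J)))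

    split⇐ : (f0 + f1 ≡ suc (inn δt ft J)) → IsPartialFlow δt ft → IsPartialFlow (I ∷ δt) f
    split⇐ e P v v< with ℕₚ.m<1+n⇒m<n∨m≡n v<
    ... | inj₁ v<J = subst₂ (Conserved v) (sym (outLow v (ℕₚ.<⇒≢ v<J)))
        (sym (inLow v (ℕₚ.<⇒≢ (ℕₚ.<-trans v<J (ℕₚ.n<1+n J))))) (P v v<J)
    ... | inj₂ refl = subst₂ (λ o i → o ≡ suc i) (sym outJ) (sym (inLow J ((ℕₚ.<⇒≢ (ℕₚ.n<1+n J))))) e

  module SplitD {j′} (δt : Vec DecoID (suc j′)) (f : FlowOn (D ∷ δt)) (bnd : suc (suc j′) ≤ n) where
    J = suc j′
    ft : FlowOn δt
    ft e = f (suc (suc (suc e)))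
    f0 = f zero
    f1 = f (suc zero)
    f2 = f (suc (suc zero))
    J≢n : J ≢ n
    J≢n = ℕₚ.<⇒≢ bnd

    outMid : ∀ v → v ≢ J → v ≢ 0 → out (D ∷ δt) f v ≡ out δt ft v
    outMid v ne nz = drop-three-zeros (contrib-≢ J v f0 (λ e → ne (sym e)))
        (contrib-≢ 0 v f1 (λ e → nz (sym e))) (contrib-≢ J v f2 (λ e → ne (sym e)))
    out0 : out (D ∷ δt) f 0 ≡ f1 + out δt ft 0
    out0 = trans (cong₂ _+_ (contrib-≢ J 0 f0 ℕₚ.1+n≢0)
        (cong₂ _+_ (contrib-≡ 0 f1) (cong₂ _+_ (contrib-≢ J 0 f2 ℕₚ.1+n≢0) refl))) refl
    outJ : out (D ∷ δt) f J ≡ f0 + f2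
    outJ = trans (cong₂ _+_ (contrib-≡ J f0)
        (cong₂ _+_ (contrib-≢ 0 J f1 (λ e → ℕₚ.1+n≢0 (sym e)))
        (cong₂ _+_ (contrib-≡ J f2) (outflow-above δt ft J ℕₚ.≤-refl ℕₚ.1+n≢0))))
        (cong (f0 +_) (ℕₚ.+-identityʳ f2))
    inLow : ∀ v → v ≢ suc J → v ≢ n → inn (D ∷ δt) f v ≡ inn δt ft v
    inLow v ne nn = drop-three-zeros (contrib-≢ (suc J) v f0 (λ e → ne (sym e)))
        (contrib-≢ (suc J) v f1 (λ e → ne (sym e))) (contrib-≢ n v f2 (λ e → nn (sym e)))

    lowNe : ∀ {v} → v < J → v ≢ suc J
    lowNe v<J = ℕₚ.<⇒≢ (ℕₚ.<-trans v<J (ℕₚ.n<1+n J))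
    lowNn : ∀ {v} → v < J → v ≢ n
    lowNn v<J = ℕₚ.<⇒≢ (ℕₚ.<-trans v<J bnd)

    inNext : suc J < n → inn (D ∷ δt) f (suc J) ≡ f0 + f1
    inNext b = trans (cong₂ _+_ (contrib-≡ (suc J) f0) (cong₂ _+_ (contrib-≡ (suc J) f1)
        (+-pres-≡0 (contrib-≢ n (suc J) f2 (λ e → ℕₚ.<⇒≢ b (sym e)))
                   (inflow-above δt ft (suc J) (ℕₚ.n<1+n J) (ℕₚ.<⇒≢ b)))))
        (cong (f0 +_) (ℕₚ.+-identityʳ f1))

    split⇒ : IsPartialFlow (D ∷ δt) f → (f1 ≡ 0) × (f0 + f2 ≡ suc (inn δt ft J)) × IsPartialFlow δt ft
    split⇒ P = proj₁ z0 ,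
               subst₂ (λ o i → o ≡ suc i) outJ (inLow J ((ℕₚ.<⇒≢ (ℕₚ.n<1+n J))) J≢n) (P J (ℕₚ.n<1+n J)) ,
               sub
      where
      z0 : f1 ≡ 0 × out δt ft 0 ≡ 0
      z0 = +≡0⇒≡0×≡0 (trans (sym out0) (trans (P 0 (s≤s z≤n)) (inflow-source (D ∷ δt) f)))
      sub : IsPartialFlow δt ft
      sub zero _ = trans (proj₂ z0) (sym (inflow-source δt ft))
      sub (suc w) w<J = subst₂ (Conserved (suc w)) (outMid (suc w) (ℕₚ.<⇒≢ w<J) ℕₚ.1+n≢0)
          (inLow (suc w) (lowNe w<J) (lowNn w<J)) (P (suc w) (ℕₚ.<-trans w<J (ℕₚ.n<1+n J)))

    split⇐ : (f1 ≡ 0) → (f0 + f2 ≡ suc (inn δt ft J)) → IsPartialFlow δt ft → IsPartialFlow (D ∷ δt) f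
    split⇐ z e P zero _ = trans out0
        (trans (cong₂ _+_ z (trans (P 0 (s≤s z≤n)) (inflow-source δt ft)))
        (sym (inflow-source (D ∷ δt) f)))
    split⇐ z e P (suc w) v< with ℕₚ.m<1+n⇒m<n∨m≡n v<
    ... | inj₁ w<J = subst₂ (Conserved (suc w)) (sym (outMid (suc w) (ℕₚ.<⇒≢ w<J) ℕₚ.1+n≢0))
        (sym (inLow (suc w) (lowNe w<J) (lowNn w<J))) (P (suc w) w<J)
    ... | inj₂ refl = subst₂ (λ o i → o ≡ suc i) (sym outJ) (sym (inLow J ((ℕₚ.<⇒≢ (ℕₚ.n<1+n J))) J≢n)) e

endpointSum-zero : ∀ end E (f : Fin (length E) → ℕ) v → (∀ e → f e ≡ 0) → endpointSum end E f v ≡ 0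
endpointSum-zero end [] f v z = refl
endpointSum-zero end (x ∷ E) f v z =
  +-pres-≡0 (trans (cong (contrib (end x) v) (z zero)) (contrib-0 (end x) v))
      (endpointSum-zero end E _ v (z ∘ suc))

module FlowCodes (n : ℕ) (n≢0 : n ≢ 0) where
  open PartialFlows n n≢0

  singleton-flow⇒zero : ∀ d (f : FlowOn (d ∷ [])) → IsPartialFlow (d ∷ []) f → ∀ e → f e ≡ 0
  singleton-flow⇒zero I f P = all-zero
    where
    outflow₀≡0 : f zero + f (suc zero) ≡ 0
    outflow₀≡0 = trans (sym (trans (cong₂ _+_ (contrib-≡ 0 (f zero))
        (cong₂ _+_ (contrib-≡ 0 (f (suc zero))) refl)) (cong (f zero +_) (ℕₚ.+-identityʳ _))))
               (trans (P 0 (s≤s z≤n)) (inflow-source (I ∷ []) f))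
    all-zero : ∀ e → f e ≡ 0
    all-zero zero = proj₁ (+≡0⇒≡0×≡0 outflow₀≡0)
    all-zero (suc zero) = proj₂ (+≡0⇒≡0×≡0 outflow₀≡0)
  singleton-flow⇒zero D f P = all-zero
    where
    outflow₀≡0 : f zero + (f (suc zero) + f (suc (suc zero))) ≡ 0
    outflow₀≡0 = trans (sym (cong₂ _+_ (contrib-≡ 0 (f zero))
        (cong₂ _+_ (contrib-≡ 0 (f (suc zero)))
        (trans (cong₂ _+_ (contrib-≡ 0 (f (suc (suc zero)))) refl) (ℕₚ.+-identityʳ _)))))
               (trans (P 0 (s≤s z≤n)) (inflow-source (D ∷ []) f))
    rest≡0 = proj₂ (+≡0⇒≡0×≡0 {f zero} outflow₀≡0)
    all-zero : ∀ e → f e ≡ 0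
    all-zero zero = proj₁ (+≡0⇒≡0×≡0 {f zero} outflow₀≡0)
    all-zero (suc zero) = proj₁ (+≡0⇒≡0×≡0 {f (suc zero)} rest≡0)
    all-zero (suc (suc zero)) = proj₂ (+≡0⇒≡0×≡0 {f (suc zero)} rest≡0)

  zero⇒singleton-flow : ∀ d (f : FlowOn (d ∷ [])) → (∀ e → f e ≡ 0) → IsPartialFlow (d ∷ []) f
  zero⇒singleton-flow d f z zero _ = trans (endpointSum-zero proj₁ (bicho n (d ∷ [])) f 0 z)
      (sym (endpointSum-zero proj₂ (bicho n (d ∷ [])) f 0 z))
  zero⇒singleton-flow d f z (suc v) (s≤s ())

  -- The J units supplied at v₁, …, v_J leave the first J + 1 levels towards v₍J₊₁₎ or the sink.
  inflow-top : ∀ {J} (δt : Vec DecoID (suc J)) f → suc J < n → IsPartialFlow δt f →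
      inn δt f (suc J) + inn δt f n ≡ J
  inflow-top {zero} (d ∷ []) f b P = cong₂ _+_
      (endpointSum-zero proj₂ (bicho n (d ∷ [])) f 1 (singleton-flow⇒zero d f P))
      (endpointSum-zero proj₂ (bicho n (d ∷ [])) f n (singleton-flow⇒zero d f P))
  inflow-top {suc J′} (I ∷ δu) f b P = goal
    where
    open SplitI δu f
    sp = split⇒ P
    ih = inflow-top δu ft (ℕₚ.<-trans (ℕₚ.n<1+n _) b) (proj₂ sp)
    hJ : inn (I ∷ δu) f (suc J) ≡ f0 + f1
    hJ = inNext b
    hn : inn (I ∷ δu) f n ≡ inn δu ft n
    hn = drop-two-zeros (contrib-≢ (suc J) n f0 (ℕₚ.<⇒≢ b)) (contrib-≢ (suc J) n f1 (ℕₚ.<⇒≢ b))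
    goal : inn (I ∷ δu) f (suc J) + inn (I ∷ δu) f n ≡ J
    goal = trans (cong₂ _+_ (trans hJ (proj₁ sp)) hn) (cong suc ih)
  inflow-top {suc J′} (D ∷ δu) f b P = goal
    where
    open SplitD δu f (ℕₚ.<⇒≤ b)
    sp = split⇒ P
    ih = inflow-top δu ft (ℕₚ.<-trans (ℕₚ.n<1+n _) b) (proj₂ (proj₂ sp))
    hJ : inn (D ∷ δu) f (suc J) ≡ f0 + f1
    hJ = inNext b
    hn : inn (D ∷ δu) f n ≡ f2 + inn δu ft n
    hn = trans (cong₂ _+_ (contrib-≢ (suc J) n f0 (ℕₚ.<⇒≢ b))
        (cong₂ _+_ (contrib-≢ (suc J) n f1 (ℕₚ.<⇒≢ b)) (cong₂ _+_ (contrib-≡ n f2) refl))) refl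
    goal : inn (D ∷ δu) f (suc J) + inn (D ∷ δu) f n ≡ J
    goal = begin
      inn (D ∷ δu) f (suc J) + inn (D ∷ δu) f n ≡⟨ cong₂ _+_ (trans hJ (cong (f0 +_) (proj₁ sp))) hn ⟩
      (f0 + 0) + (f2 + inn δu ft n) ≡⟨ cong (_+ (f2 + inn δu ft n)) (ℕₚ.+-identityʳ f0) ⟩
      f0 + (f2 + inn δu ft n) ≡⟨ sym (ℕₚ.+-assoc f0 f2 _) ⟩
      (f0 + f2) + inn δu ft n ≡⟨ cong (_+ inn δu ft n) (proj₁ (proj₂ sp)) ⟩
      suc (inn δu ft J + inn δu ft n) ≡⟨ cong suc ih ⟩
      J ∎
      where open ≡-Reasoning

  encodeFlow : ∀ {j} (δs : Vec DecoID (suc j)) → FlowOn δs → Vec ℕ j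
  encodeFlow {zero} (d ∷ []) f = []
  encodeFlow {suc j} (I ∷ δt) f = f zero ∷ encodeFlow δt (λ e → f (suc (suc e)))
  encodeFlow {suc j} (D ∷ δt) f = f zero ∷ encodeFlow δt (λ e → f (suc (suc (suc e))))

  decodeFlow : ∀ {j} (δs : Vec DecoID (suc j)) → Vec ℕ j → FlowOn δs
  decodeFlow {zero} (d ∷ []) [] e = 0
  decodeFlow {suc j} (I ∷ δt) (i ∷ cs) zero = i
  decodeFlow {suc j} (I ∷ δt) (i ∷ cs) (suc zero) = spineLength δt cs ∸ i
  decodeFlow {suc j} (I ∷ δt) (i ∷ cs) (suc (suc e)) = decodeFlow δt cs e
  decodeFlow {suc j} (D ∷ δt) (i ∷ cs) zero = i
  decodeFlow {suc j} (D ∷ δt) (i ∷ cs) (suc zero) = 0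
  decodeFlow {suc j} (D ∷ δt) (i ∷ cs) (suc (suc zero)) = spineLength δt cs ∸ i
  decodeFlow {suc j} (D ∷ δt) (i ∷ cs) (suc (suc (suc e))) = decodeFlow δt cs e

  encodeFlow-decodeFlow : ∀ {j} (δs : Vec DecoID (suc j)) cs → encodeFlow δs (decodeFlow δs cs) ≡ cs
  encodeFlow-decodeFlow {zero} (d ∷ []) [] = refl
  encodeFlow-decodeFlow {suc j} (I ∷ δt) (i ∷ cs) = cong (i ∷_) (encodeFlow-decodeFlow δt cs)
  encodeFlow-decodeFlow {suc j} (D ∷ δt) (i ∷ cs) = cong (i ∷_) (encodeFlow-decodeFlow δt cs)

  encodeFlow-cong : ∀ {j} (δs : Vec DecoID (suc j)) {f g} → (∀ e → f e ≡ g e) → encodeFlow δs f ≡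
      encodeFlow δs g
  encodeFlow-cong {zero} (d ∷ []) eq = refl
  encodeFlow-cong {suc j} (I ∷ δt) eq = cong₂ _∷_ (eq zero) (encodeFlow-cong δt (λ e → eq (suc (suc e))))
  encodeFlow-cong {suc j} (D ∷ δt) eq = cong₂ _∷_ (eq zero)
      (encodeFlow-cong δt (λ e → eq (suc (suc (suc e)))))

  decodeFlow-valid : ∀ {j} (δs : Vec DecoID (suc j)) cs → ValidCode δs cs → suc j ≤ n →
          IsPartialFlow δs (decodeFlow δs cs) ×
              (suc j < n → suc (inn δs (decodeFlow δs cs) (suc j)) ≡ spineLength δs cs)
  decodeFlow-valid {zero} (d ∷ []) [] v b = zero⇒singleton-flow d _ (λ e → refl) , λ _ → cong suc
      (endpointSum-zero proj₂ (bicho n (d ∷ [])) (decodeFlow (d ∷ []) []) 1 (λ e → refl))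
  decodeFlow-valid {suc j} (I ∷ δt) (i ∷ cs) (iv , v) b = split⇐ e1 (proj₁ ih) , inv
    where
    f = decodeFlow (I ∷ δt) (i ∷ cs)
    open SplitI δt f
    ih = decodeFlow-valid δt cs v (ℕₚ.<⇒≤ b)
    e1 : i + (spineLength δt cs ∸ i) ≡ suc (inn δt ft J)
    e1 = trans (ℕₚ.m+[n∸m]≡n iv) (sym (proj₂ ih b))
    inv : suc (suc j) < n → suc (inn (I ∷ δt) f (suc J)) ≡ suc (spineLength δt cs)
    inv b2 = cong suc (trans (inNext b2) (ℕₚ.m+[n∸m]≡n iv))
  decodeFlow-valid {suc j} (D ∷ δt) (i ∷ cs) (iv , v) b = split⇐ refl e1 (proj₁ ih) , inv
    where
    f = decodeFlow (D ∷ δt) (i ∷ cs)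
    open SplitD δt f b
    ih = decodeFlow-valid δt cs v (ℕₚ.<⇒≤ b)
    e1 : i + (spineLength δt cs ∸ i) ≡ suc (inn δt ft J)
    e1 = trans (ℕₚ.m+[n∸m]≡n iv) (sym (proj₂ ih b))
    inv : suc (suc j) < n → suc (inn (D ∷ δt) f (suc J)) ≡ suc i
    inv b2 = cong suc (trans (inNext b2) (ℕₚ.+-identityʳ i))

  encodeFlow-valid : ∀ {j} (δs : Vec DecoID (suc j)) f → IsPartialFlow δs f → suc j ≤ n →
          ValidCode δs (encodeFlow δs f) ×
              (suc j < n → suc (inn δs f (suc j)) ≡ spineLength δs (encodeFlow δs f)) ×
              (∀ e → decodeFlow δs (encodeFlow δs f) e ≡ f e)
  encodeFlow-valid {zero} (d ∷ []) f P b = tt ,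
      (λ _ → cong suc (endpointSum-zero proj₂ (bicho n (d ∷ [])) f 1 (singleton-flow⇒zero d f P))) , λ e
      → sym (singleton-flow⇒zero d f P e)
  encodeFlow-valid {suc j} (I ∷ δt) f P b = (valid , proj₁ ih) , inv , de
    where
    open SplitI δt f
    sp = split⇒ P
    ih = encodeFlow-valid δt ft (proj₂ sp) (ℕₚ.<⇒≤ b)
    slEq : spineLength δt (encodeFlow δt ft) ≡ f0 + f1
    slEq = trans (sym (proj₁ (proj₂ ih) b)) (sym (proj₁ sp))
    valid : f0 ≤ spineLength δt (encodeFlow δt ft)
    valid = subst (f0 ≤_) (sym slEq) (ℕₚ.m≤m+n f0 f1)
    inv : suc (suc j) < n → suc (inn (I ∷ δt) f (suc J)) ≡ suc (spineLength δt (encodeFlow δt ft))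
    inv b2 = cong suc (trans (inNext b2) (sym slEq))
    de : ∀ e → decodeFlow (I ∷ δt) (encodeFlow (I ∷ δt) f) e ≡ f e
    de zero = refl
    de (suc zero) = trans (cong (_∸ f0) slEq) (ℕₚ.m+n∸m≡n f0 f1)
    de (suc (suc e)) = proj₂ (proj₂ ih) e
  encodeFlow-valid {suc j} (D ∷ δt) f P b = (valid , proj₁ ih) , inv , de
    where
    open SplitD δt f b
    sp = split⇒ P
    ih = encodeFlow-valid δt ft (proj₂ (proj₂ sp)) (ℕₚ.<⇒≤ b)
    slEq : spineLength δt (encodeFlow δt ft) ≡ f0 + f2
    slEq = trans (sym (proj₁ (proj₂ ih) b)) (sym (proj₁ (proj₂ sp)))
    valid : f0 ≤ spineLength δt (encodeFlow δt ft)
    valid = subst (f0 ≤_) (sym slEq) (ℕₚ.m≤m+n f0 f2)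
    inv : suc (suc j) < n → suc (inn (D ∷ δt) f (suc J)) ≡ suc f0
    inv b2 = cong suc (trans (inNext b2) (trans (cong (f0 +_) (proj₁ sp)) (ℕₚ.+-identityʳ f0)))
    de : ∀ e → decodeFlow (D ∷ δt) (encodeFlow (D ∷ δt) f) e ≡ f e
    de zero = refl
    de (suc zero) = sym (proj₁ sp)
    de (suc (suc zero)) = trans (cong (_∸ f0) slEq) (ℕₚ.m+n∸m≡n f0 f2)
    de (suc (suc (suc e))) = proj₂ (proj₂ ih) e

≡⇒flows⤖ : ∀ {E E′ : Edges} N d → E ≡ E′ → Bijection (FlowSetoid E N d) (FlowSetoid E′ N d)
≡⇒flows⤖ {E} N d refl = Identity.bijection (FlowSetoid E N d)

module _ where
  open ℤ using (+_; -_; _-_; 0ℤ)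
  open ≡-Reasoning

  +[k+n]-+n≡+k : ∀ k n → + (k + n) - + n ≡ + k
  +[k+n]-+n≡+k k n = begin
    + (k + n) - + n          ≡⟨ cong (λ x → x - + n) (ℤₚ.pos-+ k n) ⟩
    (+ k ℤ.+ + n) - + n      ≡⟨ ℤₚ.+-assoc (+ k) (+ n) (- + n) ⟩
    + k ℤ.+ (+ n - + n)      ≡⟨ cong (λ x → + k ℤ.+ x) (ℤₚ.+-inverseʳ (+ n)) ⟩
    + k ℤ.+ 0ℤ               ≡⟨ ℤₚ.+-identityʳ (+ k) ⟩
    + k                      ∎

  +m-+n≡+k⇒m≡k+n : ∀ m n k → + m - + n ≡ + k → m ≡ k + n
  +m-+n≡+k⇒m≡k+n m n k e =
    ℤₚ.+-injective (ℤ-group.∙-cancelʳ (- + n) (+ m) (+ (k + n)) (trans e (sym (+[k+n]-+n≡+k k n))))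
    where import Algebra.Properties.AbelianGroup ℤₚ.+-0-abelianGroup as ℤ-group

module FlowsAsCodes (m : ℕ) where
  open ℤ using (+_; -_; _-_; 1ℤ)

  n : ℕ
  n = suc (suc m)

  open PartialFlows n (λ ())
  open FlowCodes n (λ ())

  demand-inner : ∀ w → suc w ≢ n → demand n (suc w) ≡ 1ℤ
  demand-inner w w≢n with suc w ℕ.≟ n
  ... | yes w≡n = ⊥-elim (w≢n w≡n)
  ... | no _ = refl

  demand-sink : demand n n ≡ - (+ suc m)
  demand-sink with n ℕ.≟ n
  ... | yes _ = refl
  ... | no n≢n = ⊥-elim (n≢n refl)

  Conserved⇒demand : ∀ v o i → v < n → Conserved v o i → + o - + i ≡ demand n v
  Conserved⇒demand zero o i _ e = trans (cong (λ t → + t - + i) e) (+[k+n]-+n≡+k 0 i)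
  Conserved⇒demand (suc w) o i w<n e =
    trans (trans (cong (λ t → + t - + i) e) (+[k+n]-+n≡+k 1 i)) (sym (demand-inner w (ℕₚ.<⇒≢ w<n)))

  demand⇒Conserved : ∀ v o i → v < n → + o - + i ≡ demand n v → Conserved v o i
  demand⇒Conserved zero o i _ e = +m-+n≡+k⇒m≡k+n o i 0 e
  demand⇒Conserved (suc w) o i w<n e = +m-+n≡+k⇒m≡k+n o i 1 (trans e (demand-inner w (ℕₚ.<⇒≢ w<n)))

  inflow-sink : ∀ (δ : Vec DecoID n) f → IsPartialFlow δ f → inn δ f n ≡ suc m
  inflow-sink (I ∷ δt) f P =
    trans (cong₂ _+_ (contrib-≡ n f0) (cong₂ _+_ (contrib-≡ n f1) refl))
    (trans (sym (ℕₚ.+-assoc f0 f1 _)) (trans (cong (_+ inn δt ft n) (proj₁ sp))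
    (cong suc (inflow-top δt ft (ℕₚ.n<1+n _) (proj₂ sp)))))
    where
    open SplitI δt f
    sp = split⇒ P
  inflow-sink (D ∷ δt) f P =
    trans (cong₂ _+_ (contrib-≡ n f0)
        (cong₂ _+_ (trans (contrib-≡ n f1) (proj₁ sp)) (cong₂ _+_ (contrib-≡ n f2) refl)))
    (trans (sym (ℕₚ.+-assoc f0 f2 _)) (trans (cong (_+ inn δt ft n) (proj₁ (proj₂ sp)))
    (cong suc (inflow-top δt ft (ℕₚ.n<1+n _) (proj₂ (proj₂ sp))))))
    where
    open SplitD δt f ℕₚ.≤-refl
    sp = split⇒ P

  module _ (δ : Vec DecoID n) where

    private
      E : Edges
      E = bicho n δ

      Balanced : (Fin (length E) → ℕ) → ℕ → Set
      Balanced f v = + outflow′ E f v - + inflow′ E f v ≡ demand n v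

      isFlow⇒balanced : ∀ f → IsFlow E n (demand n) f → ∀ v → v < suc n → Balanced f v
      isFlow⇒balanced f H v v<1+n = subst (Balanced f) (Finₚ.toℕ-fromℕ< v<1+n)
        (subst₂ (λ o i → + o - + i ≡ demand n (toℕ (Fin.fromℕ< v<1+n)))
                (outflow≡outflow′ E f _) (inflow≡inflow′ E f _) (H (Fin.fromℕ< v<1+n)))

    isFlow⇒isPartialFlow : ∀ f → IsFlow E n (demand n) f → IsPartialFlow δ f
    isFlow⇒isPartialFlow f H v v<n =
      demand⇒Conserved v _ _ v<n (isFlow⇒balanced f H v (ℕₚ.<-trans v<n (ℕₚ.n<1+n n)))

    isPartialFlow⇒isFlow : ∀ f → IsPartialFlow δ f → IsFlow E n (demand n) f
    isPartialFlow⇒isFlow f P v =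
      subst₂ (λ o i → + o - + i ≡ demand n (toℕ v))
             (sym (outflow≡outflow′ E f (toℕ v))) (sym (inflow≡inflow′ E f (toℕ v))) balanced
      where
      balanced : Balanced f (toℕ v)
      balanced with ℕₚ.m<1+n⇒m<n∨m≡n (Finₚ.toℕ<n v)
      ... | inj₁ v<n = Conserved⇒demand (toℕ v) _ _ v<n (P (toℕ v) v<n)
      ... | inj₂ v≡n rewrite v≡n | outflow-above δ f n ℕₚ.≤-refl (λ ()) | inflow-sink δ f P =
        trans (ℤₚ.+-identityˡ _) (sym demand-sink)

    flows↔codes : Inverse (FlowSetoid E n (demand n)) (CodeSetoid δ)
    flows↔codes = record
      { to = λ F → encodeFlow δ (Flow.flow F) , proj₁
          (encodeFlow-valid δ (Flow.flow F) (partial F) ℕₚ.≤-refl)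
      ; from = λ c → record
          { flow = decodeFlow δ (proj₁ c)
          ; isFlow = isPartialFlow⇒isFlow _ (proj₁ (decodeFlow-valid δ (proj₁ c) (proj₂ c) ℕₚ.≤-refl)) }
      ; to-cong = encodeFlow-cong δ
      ; from-cong = λ { refl e → refl }
      ; inverse = (λ {c} eq → trans (encodeFlow-cong δ eq) (encodeFlow-decodeFlow δ (proj₁ c))) ,
                  (λ {F} eq e → trans (cong (λ c → decodeFlow δ c e) eq)
                                      (proj₂ (proj₂ (encodeFlow-valid δ (Flow.flow F) (partial F)
                                          ℕₚ.≤-refl)) e)) }
      where
      partial : (F : Flow E n (demand n)) → IsPartialFlow δ (Flow.flow F)
      partial F = isFlow⇒isPartialFlow (Flow.flow F) (Flow.isFlow F)

theorem7p12 : (n : ℕ) → 2 ≤ n → (δ : Vec DecoID n) →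
    (∀ (k : Fin n) → toℕ k ≡ 0 → lookup δ k ≡ I) →
    (∀ (k : Fin n) → toℕ k ≡ n ∸ 1 → lookup δ k ≡ I) →
    Bijection (FlowSetoid (Bic (map toDeco δ)) n (demand n)) (PermutreeSetoid δ)
theorem7p12 (suc (suc m)) (s≤s (s≤s z≤n)) δ _ _ =
  Composition.bijection (≡⇒flows⤖ n (demand n) (Bic≡bicho δ))
    (Composition.bijection (Inverse⇒Bijection (flows↔codes δ)) (codes⤖permutrees δ))
  where open FlowsAsCodes m
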